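{- Let $h\colon[n]\to[n]$ be a Hessenberg function and let $w\in\mathfrak S_n$ be a well-organized generator for $h$ with $Y(w)=\{y_0<y_1<\cdots<y_r\}$. Then: (1) $\overline w$ is a generator for $h$; (2) $[\overline w,w_0]=\{u\in[w,w_0]\mid u(n)=1\}$; (3) $\{(i,n)\mid (i,n)\in E_{w,h}(\overline w)\}=\{(w^{ -1}(y_s),n)\mid 0\le s<r,\ h(w^{ -1}(y_s))=n\}$.
   Context: A Hessenberg function is a nondecreasing $h\colon[n]\to[n]$ with $h(i)\ge i$. Permutations are in one-line notation; for $u\in\mathfrak S_n$ and $i<j$, $u(i,j)$ is obtained by swapping the entries in positions $i$ and $j$, while $(a,b)u$ is obtained by swapping the values $a$ and $b$. The Bruhat order $\preceq$ is the reflexive–transitive closure of $u\prec u(i,j)$ when $u(i,j)$ has more inversions than $u$; $w_0=n(n-1)\cdots1$, $[v,w_0]=\{u\mid v\preceq u\preceq w_0\}$. A generator for $h$ is a $w$ with $w^{ -1}(w(i)+1)\le h(i)$ whenever $w(i)\le n-1$. For a generator $w$ and $u\in[w,w_0]$, $E_{w,h}(u)=\{(i,j)\mid 1\le i<j\le h(i),\ u(i,j)\succeq w\}$. For $w\in\mathfrak S_n$, $Y(w)=\{w(i)\mid i\ge w^{ -1}(1),\ w(i)\le w(n)\}$, written $\{y_0<\cdots<y_r\}$ (so $y_0=1$, $y_r=w(n)$); $w$ is well-organized if $w^{ -1}(y_0)<w^{ -1}(y_1)<\cdots<w^{ -1}(y_r)=n$. Define $\overline w_0=w$, $\overline w_m=(1,y_m)\overline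 w_{m-1}$ for $m=1,\dots,r$, and $\overline w=\overline w_r$. -}

module Defs where

open import Data.Nat as ℕ using (ℕ; zero; suc)
open import Data.Fin using (Fin; toℕ; fromℕ; fromℕ<; _<_; _≤_; _≟_; _<?_; _≤?_)
open import Data.Fin.Permutation
  using (Permutation′; _⟨$⟩ʳ_; _⟨$⟩ˡ_; _∘ₚ_; transpose; reverse)
  renaming (_≈_ to _≈ₚ_)
open import Data.List using (List; []; _∷_; filter; length; allFin; cartesianProduct; drop; foldl)
open import Data.Product using (Σ; _×_; _,_; proj₁; proj₂)
open import Relation.Nullary using (Dec; _×-dec_)

-- Conventions: the paper's [n] = {1,…,n} is encoded as Fin N with N = n,
-- via k ↦ toℕ k + 1.  So position/value 1 is Fin.zero and n is fromℕ _.
-- Permutations of [n] are stdlib permutations (bijections) of Fin n;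
-- u(i) = u ⟨$⟩ʳ i and u⁻¹(a) = u ⟨$⟩ˡ a.

Perm : ℕ → Set
Perm = Permutation′

IsHessenberg : {N : ℕ} → (Fin N → Fin N) → Set
IsHessenberg {N} h = (∀ (i j : Fin N) → i ≤ j → h i ≤ h j) × (∀ (i : Fin N) → i ≤ h i)

-- u(i,j): swap the entries in positions i and j:  (u(i,j))(k) = u(τ_{ij}(k)).
swapPos : {N : ℕ} → Perm N → Fin N → Fin N → Perm N
swapPos u i j = transpose i j ∘ₚ u

-- (a,b)u: swap the values a and b:  ((a,b)u)(k) = τ_{ab}(u(k)).
swapVal : {N : ℕ} → Fin N → Fin N → Perm N → Perm N
swapVal a b u = u ∘ₚ transpose a b

IsInv : {N : ℕ} → Perm N → Fin N × Fin N → Set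
IsInv u (i , j) = (i < j) × ((u ⟨$⟩ʳ j) < (u ⟨$⟩ʳ i))

isInv? : {N : ℕ} (u : Perm N) (p : Fin N × Fin N) → Dec (IsInv u p)
isInv? u (i , j) = (i <? j) ×-dec ((u ⟨$⟩ʳ j) <? (u ⟨$⟩ʳ i))

inversions : {N : ℕ} → Perm N → ℕ
inversions {N} u = length (filter (isInv? u) (cartesianProduct (allFin N) (allFin N)))

data _⪯_ {N : ℕ} : Perm N → Perm N → Set where
  ⪯-refl : ∀ {u v} → u ≈ₚ v → u ⪯ v
  ⪯-step : ∀ {u v x} (i j : Fin N) → u ⪯ v → i < j →
           inversions v ℕ.< inversions (swapPos v i j) →
           swapPos v i j ≈ₚ x → u ⪯ x

infix 4 _⪯_

w₀ : {N : ℕ} → Perm N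
w₀ = reverse

InInterval : {N : ℕ} → Perm N → Perm N → Set
InInterval v u = (v ⪯ u) × (u ⪯ w₀)

IsGenerator : {N : ℕ} → (Fin N → Fin N) → Perm N → Set
IsGenerator {N} h w =
  ∀ (i : Fin N) (p : suc (toℕ (w ⟨$⟩ʳ i)) ℕ.< N) →
    (w ⟨$⟩ˡ fromℕ< p) ≤ h i

InE : {N : ℕ} → Perm N → (Fin N → Fin N) → Perm N → Fin N → Fin N → Set
InE w h u i j = (i < j) × (j ≤ h i) × (w ⪯ swapPos u i j)

-- Y(w) = {w(i) | i ≥ w⁻¹(1), w(i) ≤ w(n)}, described by its values a = w(i).
-- Only meaningful for n ≥ 1, so we use Fin (suc m) (n = suc m).
InY : {m : ℕ} → Perm (suc m) → Fin (suc m) → Set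
InY {m} w a = ((w ⟨$⟩ˡ Fin.zero) ≤ (w ⟨$⟩ˡ a)) × (a ≤ (w ⟨$⟩ʳ fromℕ m))

inY? : {m : ℕ} (w : Perm (suc m)) (a : Fin (suc m)) → Dec (InY w a)
inY? {m} w a = ((w ⟨$⟩ˡ Fin.zero) ≤? (w ⟨$⟩ˡ a)) ×-dec (a ≤? (w ⟨$⟩ʳ fromℕ m))

Ylist : {m : ℕ} → Perm (suc m) → List (Fin (suc m))
Ylist {m} w = filter (inY? w) (allFin (suc m))

IsWellOrganized : {m : ℕ} → Perm (suc m) → Set
IsWellOrganized {m} w =
  (∀ (a b : Fin (suc m)) → InY w a → InY w b → a < b → (w ⟨$⟩ˡ a) < (w ⟨$⟩ˡ b))
  × ((w ⟨$⟩ˡ (w ⟨$⟩ʳ fromℕ m)) ≡ fromℕ m)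
  where open import Relation.Binary.PropositionalEquality using (_≡_)

-- w̄: w̄₀ = w, w̄_m = (1, y_m) w̄_{m-1} for m = 1,…,r.
wbar : {m : ℕ} → Perm (suc m) → Perm (suc m)
wbar w = foldl (λ v y → swapVal Fin.zero y v) w (drop 1 (Ylist w))

-- Bruhat comparisons are decided by the rank-matrix criterion: v ⪯ u iff every count
-- #{a < x | u a < k} is at most the corresponding count for v.  Necessity holds because swapping
-- an ascent lowers the counts by one on a single rectangle; sufficiency because, when v ⊑ u and
-- v ≠ u, swapping v at its first disagreement with u against a suitable later position stays ⊑ u.
--
-- The permutation w̄ replaces each value y_s (s < r) of w by y_{s+1} and w(n) = y_r by 1.  Hence
-- w ≤ w̄ entrywise away from n, and w ⪯ w̄.  (1) Values strictly between consecutive y_s sit before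
-- w⁻¹(1), so the generator condition of w at their positions is inherited by w̄ through the
-- monotonicity of h.  (2) Where the counts of w̄ drop below those of w, well-organizedness leaves
-- only position n carrying a small value late, and u(n) = 1 supplies it.  (3) w ⪯ w̄(i, n) forces
-- w⁻¹(1) ≤ i and w̄(i) ≤ w(n), i.e. w(i) ∈ Y; conversely the counts of w̄(i, n) exceed those of w̄
-- by one exactly on a rectangle, where the counts of w̄ are strictly below those of w (witnessed at
-- w⁻¹ of the largest element of Y below the threshold).

module Submission where

open import Defs
open import Data.Nat using (ℕ; suc)
open import Data.Fin using (Fin; fromℕ; _<_)
open import Data.Fin.Permutation using (_⟨$⟩ʳ_; _⟨$⟩ˡ_)
open import Data.Product using (Σ; _×_; _,_)
open import Function.Bundles using (_⇔_)
open import Relation.Binary.PropositionalEquality using (_≡_)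

open import Data.Empty using (⊥; ⊥-elim)
open import Data.Fin as F using (toℕ; fromℕ<)
import Data.Fin.Permutation.Components as PC
open import Data.Fin.Permutation using (Permutation′; transpose; inverseˡ; inverseʳ)
  renaming (_≈_ to _≈ₚ_)
import Data.Fin.Properties as FP
open import Data.List using (List; []; _∷_; _++_; length; filter; map; tabulate; allFin; cartesianProduct; foldl; drop)
import Data.List.Properties as LP
open import Data.List.Membership.Propositional using (_∈_; _∉_)
import Data.List.Membership.Propositional.Properties as MP
open import Data.List.Relation.Unary.All as All using (All; _∷_)
open import Data.List.Relation.Unary.AllPairs using (AllPairs; _∷_)
import Data.List.Relation.Unary.AllPairs.Properties as AllPairsP
open import Data.List.Relation.Unary.Any using (here; there)
open import Data.Nat as ℕ using (zero; _+_; z≤n; s≤s)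
import Data.Nat.Properties as ℕP
open import Data.Product using (proj₁; proj₂)
open import Data.Sum using (_⊎_; inj₁; inj₂; [_,_]′)
open import Data.Vec.Functional using (updateAt)
open import Data.Vec.Functional.Properties using (updateAt-updates; updateAt-minimal)
open import Function using (_∘_; const)
open import Data.Nat.Tactic.RingSolver using (solve-∀)
open import Function.Bundles using (mk⇔)
open import Relation.Binary using (Tri; tri<; tri≈; tri>)
open import Relation.Binary.PropositionalEquality using (_≢_; refl; sym; trans; cong; cong₂; subst; subst₂; module ≡-Reasoning)
open import Relation.Nullary using (Dec; yes; no; ¬_; ¬?; _×-dec_; decidable-stable)
open import Relation.Unary using (Pred; Decidable)
open import Algebra.Properties.CommutativeMonoid.Sum ℕP.+-0-commutativeMonoid
  using (sum; sum-cong-≗; ∑-distrib-+; sum-permute)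

χ : ∀ {p} {P : Set p} → Dec P → ℕ
χ (yes _) = 1
χ (no _) = 0

module _ {p q} {P : Set p} {Q : Set q} where

  χ-mono : (P → Q) → (d : Dec P) (e : Dec Q) → χ d ℕ.≤ χ e
  χ-mono f (yes p) (yes q) = ℕP.≤-refl
  χ-mono f (yes p) (no ¬q) = ⊥-elim (¬q (f p))
  χ-mono f (no _) e = z≤n

  χ-cong : (P → Q) → (Q → P) → (d : Dec P) (e : Dec Q) → χ d ≡ χ e
  χ-cong f g (yes p) (yes q) = refl
  χ-cong f g (yes p) (no ¬q) = ⊥-elim (¬q (f p))
  χ-cong f g (no ¬p) (yes q) = ⊥-elim (¬p (g q))
  χ-cong f g (no _) (no _) = refl

  χ-< : ¬ P → Q → (d : Dec P) (e : Dec Q) → χ d ℕ.< χ e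
  χ-< ¬p q (yes p) e = ⊥-elim (¬p p)
  χ-< ¬p q (no _) (yes _) = s≤s z≤n
  χ-< ¬p q (no _) (no ¬q) = ⊥-elim (¬q q)

module _ {p} {P : Set p} where

  χ≡0 : ¬ P → (d : Dec P) → χ d ≡ 0
  χ≡0 ¬p (yes p) = ⊥-elim (¬p p)
  χ≡0 ¬p (no _) = refl

  χ≡1 : P → (d : Dec P) → χ d ≡ 1
  χ≡1 p (yes _) = refl
  χ≡1 p (no ¬p) = ⊥-elim (¬p p)

χ-⊎ : ∀ {q r s} {Q : Set q} {R : Set r} {S : Set s} →
  (Q → R ⊎ S) → (R → Q) → (S → Q) → (R → ¬ S) →
  (d : Dec Q) (d₁ : Dec R) (d₂ : Dec S) → χ d ≡ χ d₁ + χ d₂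
χ-⊎ split r⇒q s⇒q disj (yes q) (yes r) (yes s) = ⊥-elim (disj r s)
χ-⊎ split r⇒q s⇒q disj (yes q) (yes r) (no _) = refl
χ-⊎ split r⇒q s⇒q disj (yes q) (no _) (yes s) = refl
χ-⊎ split r⇒q s⇒q disj (yes q) (no ¬r) (no ¬s) with split q
... | inj₁ r = ⊥-elim (¬r r)
... | inj₂ s = ⊥-elim (¬s s)
χ-⊎ split r⇒q s⇒q disj (no ¬q) (yes r) _ = ⊥-elim (¬q (r⇒q r))
χ-⊎ split r⇒q s⇒q disj (no ¬q) (no _) (yes s) = ⊥-elim (¬q (s⇒q s))
χ-⊎ split r⇒q s⇒q disj (no ¬q) (no _) (no _) = refl

sum-mono-≤ : ∀ {n} {f g : Fin n → ℕ} → (∀ a → f a ℕ.≤ g a) → sum f ℕ.≤ sum g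
sum-mono-≤ {zero} f≤g = z≤n
sum-mono-≤ {suc n} f≤g = ℕP.+-mono-≤ (f≤g F.zero) (sum-mono-≤ (f≤g ∘ F.suc))

sum-mono-< : ∀ {n} {f g : Fin n → ℕ} → (∀ a → f a ℕ.≤ g a) → (p : Fin n) → f p ℕ.< g p → sum f ℕ.< sum g
sum-mono-< {suc n} f≤g F.zero lt = ℕP.+-mono-<-≤ lt (sum-mono-≤ (f≤g ∘ F.suc))
sum-mono-< {suc n} f≤g (F.suc p) lt = ℕP.+-mono-≤-< (f≤g F.zero) (sum-mono-< (f≤g ∘ F.suc) p lt)

sum-zero : ∀ {n} {f : Fin n → ℕ} → (∀ a → f a ≡ 0) → sum f ≡ 0
sum-zero {zero} f≡0 = refl
sum-zero {suc n} f≡0 rewrite f≡0 F.zero = sum-zero (f≡0 ∘ F.suc)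

term≤sum : ∀ {n} → (f : Fin n → ℕ) (p : Fin n) → f p ℕ.≤ sum f
term≤sum {suc n} f F.zero = ℕP.m≤m+n _ _
term≤sum {suc n} f (F.suc p) = ℕP.≤-trans (term≤sum (f ∘ F.suc) p) (ℕP.m≤n+m _ _)

sum-exchange : ∀ {n} {f g : Fin n → ℕ} (p : Fin n) → (∀ a → a ≢ p → f a ≡ g a) →
  sum f + g p ≡ sum g + f p
sum-exchange {suc n} {f} {g} F.zero f≡g
  rewrite sum-cong-≗ {x = f ∘ F.suc} {g ∘ F.suc} (λ a → f≡g (F.suc a) (λ ()))
  = swap-outer (f F.zero) (sum (g ∘ F.suc)) (g F.zero)
  where
  swap-outer : ∀ x s y → x + s + y ≡ y + s + x
  swap-outer = solve-∀
sum-exchange {suc n} {f} {g} (F.suc p) f≡g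
  rewrite f≡g F.zero (λ ())
  = begin
    g F.zero + sum (f ∘ F.suc) + g (F.suc p) ≡⟨ ℕP.+-assoc (g F.zero) _ _ ⟩
    g F.zero + (sum (f ∘ F.suc) + g (F.suc p)) ≡⟨ cong (g F.zero +_) (sum-exchange p λ a a≢p → f≡g (F.suc a) (a≢p ∘ FP.suc-injective)) ⟩
    g F.zero + (sum (g ∘ F.suc) + f (F.suc p)) ≡⟨ ℕP.+-assoc (g F.zero) _ _ ⟨
    g F.zero + sum (g ∘ F.suc) + f (F.suc p) ∎
  where open ≡-Reasoning

sum-mono-<-at-two : ∀ {n} {f g : Fin n → ℕ} (i j : Fin n) → i ≢ j →
  (∀ a → a ≢ i → a ≢ j → f a ℕ.≤ g a) → f i + f j ℕ.< g i + g j → sum f ℕ.< sum g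
sum-mono-<-at-two {n} {f} {g} i j i≢j f≤g lt =
  ℕP.+-cancelʳ-< (g i + g j) (sum f) (sum g) (begin-strict
    sum f + (g i + g j)       ≤⟨ ℕP.+-monoˡ-≤ _ (sum-mono-≤ f≤h₂) ⟩
    sum h₂ + (g i + g j)      ≡⟨ shuffle (sum h₂) (g i) (g j) ⟩
    (sum h₂ + g j) + g i      ≡⟨ cong (_+ g i) exchange-j ⟨
    (sum h₁ + f j) + g i      ≡⟨ trans (ℕP.+-assoc (sum h₁) _ _) (shuffle (sum h₁) (f j) (g i)) ⟩
    (sum h₁ + g i) + f j      ≡⟨ cong (_+ f j) exchange-i ⟨
    (sum g + f i) + f j       ≡⟨ ℕP.+-assoc (sum g) _ _ ⟩
    sum g + (f i + f j)       <⟨ ℕP.+-monoʳ-< (sum g) lt ⟩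
    sum g + (g i + g j)       ∎)
  where
  open ℕP.≤-Reasoning
  shuffle : ∀ x y z → x + (y + z) ≡ x + z + y
  shuffle = solve-∀
  h₁ h₂ : Fin n → ℕ
  h₁ = updateAt g i (const (f i))
  h₂ = updateAt h₁ j (const (f j))
  exchange-i : sum g + f i ≡ sum h₁ + g i
  exchange-i = subst (λ z → sum g + z ≡ sum h₁ + g i) (updateAt-updates i g)
    (sum-exchange i λ a a≢i → sym (updateAt-minimal a i g a≢i))
  exchange-j : sum h₁ + f j ≡ sum h₂ + g j
  exchange-j = subst₂ (λ z z′ → sum h₁ + z ≡ sum h₂ + z′) (updateAt-updates j h₁)
    (updateAt-minimal j i g (i≢j ∘ sym))
    (sum-exchange j λ a a≢j → sym (updateAt-minimal a j h₁ a≢j))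
  f≤h₂ : ∀ a → f a ℕ.≤ h₂ a
  f≤h₂ a with a F.≟ j
  ... | yes refl = ℕP.≤-reflexive (sym (updateAt-updates a h₁))
  ... | no a≢j with a F.≟ i
  ... | yes refl = ℕP.≤-reflexive (sym (trans (updateAt-minimal a j h₁ a≢j) (updateAt-updates a g)))
  ... | no a≢i = ℕP.≤-trans (f≤g a a≢i a≢j)
        (ℕP.≤-reflexive (sym (trans (updateAt-minimal a j h₁ a≢j) (updateAt-minimal a i g a≢i))))

sum-reindex : ∀ {n} → (f : Fin n → ℕ) (π : Permutation′ n) → sum (f ∘ (π ⟨$⟩ʳ_)) ≡ sum f
sum-reindex f π = sym (sum-permute f π)

module _ {n p} {P : Fin n → Set p} (P? : ∀ a → Dec (P a)) where

  least : (a : Fin n) → P a → Σ (Fin n) λ b → P b × (∀ c → c F.< b → ¬ P c)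
  least a pa = go (suc (toℕ a)) a ℕP.≤-refl pa
    where
    go : (k : ℕ) (a : Fin n) → toℕ a ℕ.< k → P a → Σ (Fin n) λ b → P b × (∀ c → c F.< b → ¬ P c)
    go (suc k) a a<k pa with FP.any? (λ c → (c F.<? a) ×-dec P? c)
    ... | yes (c , c<a , pc) = go k c (ℕP.<-≤-trans c<a (ℕP.≤-pred a<k)) pc
    ... | no none = a , pa , λ c c<a pc → none (c , c<a , pc)

  greatest : (a : Fin n) → P a → Σ (Fin n) λ b → P b × (∀ c → b F.< c → ¬ P c)
  greatest a pa = go n a (ℕP.m∸n≤m n (suc (toℕ a))) pa
    where
    go : (k : ℕ) (a : Fin n) → n ℕ.∸ suc (toℕ a) ℕ.≤ k → P a → Σ (Fin n) λ b → P b × (∀ c → b F.< c → ¬ P c)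
    go k a bound pa with FP.any? (λ c → (a F.<? c) ×-dec P? c)
    ... | no none = a , pa , λ c a<c pc → none (c , a<c , pc)
    ... | yes (c , a<c , pc) with ℕP.<-≤-trans (ℕP.∸-monoʳ-< (s≤s a<c) (FP.toℕ<n c)) bound
    ...   | s≤s bound′ = go _ c bound′ pc

τ : ∀ {n} → Fin n → Fin n → Fin n → Fin n
τ = PC.transpose

module _ {n} (i j : Fin n) where

  τ-i : τ i j i ≡ j
  τ-i with i F.≟ i
  ... | yes _ = refl
  ... | no i≢i = ⊥-elim (i≢i refl)

  τ-j : τ i j j ≡ i
  τ-j with j F.≟ i
  ... | yes j≡i = j≡i
  ... | no _ with j F.≟ j
  ... | yes _ = refl
  ... | no j≢j = ⊥-elim (j≢j refl)

  τ-other : ∀ {k} → k ≢ i → k ≢ j → τ i j k ≡ k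
  τ-other {k} k≢i k≢j with k F.≟ i
  ... | yes k≡i = ⊥-elim (k≢i k≡i)
  ... | no _ with k F.≟ j
  ... | yes k≡j = ⊥-elim (k≢j k≡j)
  ... | no _ = refl

  τ-preserves : ∀ {p} (P : Fin n → Set p) → (P i → P j) → (P j → P i) → ∀ {k} → P k → P (τ i j k)
  τ-preserves P i⇒j j⇒i {k} pk = cases (k F.≟ i) (k F.≟ j)
    where
    cases : Dec (k ≡ i) → Dec (k ≡ j) → P (τ i j k)
    cases (yes refl) _ = subst P (sym τ-i) (i⇒j pk)
    cases (no _) (yes refl) = subst P (sym τ-j) (j⇒i pk)
    cases (no k≢i) (no k≢j) = subst P (sym (τ-other k≢i k≢j)) pk

  τ-involutive : ∀ k → τ i j (τ i j k) ≡ k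
  τ-involutive k = cases (k F.≟ i) (k F.≟ j)
    where
    cases : Dec (k ≡ i) → Dec (k ≡ j) → τ i j (τ i j k) ≡ k
    cases (yes refl) _ = trans (cong (τ i j) τ-i) τ-j
    cases (no _) (yes refl) = trans (cong (τ i j) τ-j) τ-i
    cases (no k≢i) (no k≢j) = trans (cong (τ i j) (τ-other k≢i k≢j)) (τ-other k≢i k≢j)

⟨$⟩ʳ-injective : ∀ {n} (u : Perm n) {a b : Fin n} → u ⟨$⟩ʳ a ≡ u ⟨$⟩ʳ b → a ≡ b
⟨$⟩ʳ-injective u {a} {b} ua≡ub = begin
  a                     ≡⟨ inverseˡ u ⟨
  u ⟨$⟩ˡ (u ⟨$⟩ʳ a)     ≡⟨ cong (u ⟨$⟩ˡ_) ua≡ub ⟩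
  u ⟨$⟩ˡ (u ⟨$⟩ʳ b)     ≡⟨ inverseˡ u ⟩
  b                     ∎
  where open ≡-Reasoning

<⇒≢ : ∀ {n} {a b : Fin n} → a F.< b → a ≢ b
<⇒≢ a<b refl = ℕP.<-irrefl refl a<b

module _ {a b p} {A : Set a} {B : Set b} {P : Pred (A × B) p} (P? : Decidable P) where

  length-filter-tabulate : ∀ {n} (f : Fin n → A × B) →
    length (filter P? (tabulate f)) ≡ sum (λ k → χ (P? (f k)))
  length-filter-tabulate {zero} f = refl
  length-filter-tabulate {suc n} f with P? (f F.zero)
  ... | yes _ = cong suc (length-filter-tabulate (f ∘ F.suc))
  ... | no _ = length-filter-tabulate (f ∘ F.suc)

  length-filter-cartesianProduct : ∀ {n} (f : Fin n → A) (ys : List B) →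
    length (filter P? (cartesianProduct (tabulate f) ys))
      ≡ sum (λ k → length (filter P? (map (f k ,_) ys)))
  length-filter-cartesianProduct {zero} f ys = refl
  length-filter-cartesianProduct {suc n} f ys = begin
    length (filter P? (map (f F.zero ,_) ys ++ rest))
      ≡⟨ cong length (LP.filter-++ P? (map (f F.zero ,_) ys) rest) ⟩
    length (filter P? (map (f F.zero ,_) ys) ++ filter P? rest)
      ≡⟨ LP.length-++ (filter P? (map (f F.zero ,_) ys)) ⟩
    length (filter P? (map (f F.zero ,_) ys)) + length (filter P? rest)
      ≡⟨ cong (length (filter P? (map (f F.zero ,_) ys)) +_) (length-filter-cartesianProduct (f ∘ F.suc) ys) ⟩
    sum (λ k → length (filter P? (map (f k ,_) ys))) ∎
    where
    open ≡-Reasoning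
    rest = cartesianProduct (tabulate (f ∘ F.suc)) ys

row : ∀ {n} → Perm n → Fin n → ℕ
row u a = sum λ b → χ (isInv? u (a , b))

inversions≡sum-row : ∀ {n} (u : Perm n) → inversions u ≡ sum (row u)
inversions≡sum-row {n} u =
  trans (length-filter-cartesianProduct (isInv? u) (λ a → a) (allFin n))
        (sum-cong-≗ λ a → trans (cong (length ∘ filter (isInv? u)) (LP.map-tabulate (λ b → b) (a ,_)))
                                (length-filter-tabulate (isInv? u) (a ,_)))

inversions≤ : ∀ {n} (u : Perm n) → inversions u ℕ.≤ length (cartesianProduct (allFin n) (allFin n))
inversions≤ {n} u = LP.length-filter (isInv? u) (cartesianProduct (allFin n) (allFin n))

inversions-cong : ∀ {n} {u v : Perm n} → u ≈ₚ v → inversions u ≡ inversions v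
inversions-cong {n} {u} {v} u≈v = begin
  inversions u      ≡⟨ inversions≡sum-row u ⟩
  sum (row u)       ≡⟨ sum-cong-≗ {n} (λ a → sum-cong-≗ {n} λ b →
                         χ-cong (λ (a<b , ub<ua) → a<b , subst₂ F._<_ (u≈v b) (u≈v a) ub<ua)
                                (λ (a<b , vb<va) → a<b , subst₂ F._<_ (sym (u≈v b)) (sym (u≈v a)) vb<va) _ _) ⟩
  sum (row v)       ≡⟨ inversions≡sum-row v ⟨
  inversions v      ∎
  where open ≡-Reasoning

module SwapAscent {n} (u : Perm n) (i j : Fin n) (i<j : i F.< j) (ui<uj : u ⟨$⟩ʳ i F.< u ⟨$⟩ʳ j) where

  private
    u′ = swapPos u i j
    T = τ i j

    u′-i : u′ ⟨$⟩ʳ i ≡ u ⟨$⟩ʳ j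
    u′-i = cong (u ⟨$⟩ʳ_) (τ-i i j)

    u′-j : u′ ⟨$⟩ʳ j ≡ u ⟨$⟩ʳ i
    u′-j = cong (u ⟨$⟩ʳ_) (τ-j i j)

    u′-other : ∀ {b} → b ≢ i → b ≢ j → u′ ⟨$⟩ʳ b ≡ u ⟨$⟩ʳ b
    u′-other b≢i b≢j = cong (u ⟨$⟩ʳ_) (τ-other i j b≢i b≢j)

  -- When i and j lie on the same side of a, the row of a is merely reindexed by τ.
  row-same-side : ∀ a → a ≢ i → a ≢ j → (a F.< i → a F.< j) → (a F.< j → a F.< i) → row u′ a ≡ row u a
  row-same-side a a≢i a≢j i⇒j j⇒i = begin
    row u′ a                           ≡⟨ sum-cong-≗ (λ b → χ-cong (to b) (from b) _ _) ⟩
    sum (λ b → χ (isInv? u (a , T b))) ≡⟨ sum-reindex (λ c → χ (isInv? u (a , c))) (transpose i j) ⟩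
    row u a                            ∎
    where
    open ≡-Reasoning
    ua≡ : u′ ⟨$⟩ʳ a ≡ u ⟨$⟩ʳ a
    ua≡ = u′-other a≢i a≢j
    to : ∀ b → IsInv u′ (a , b) → IsInv u (a , T b)
    to b (a<b , lt) = τ-preserves i j (a F.<_) i⇒j j⇒i a<b , subst (u ⟨$⟩ʳ T b F.<_) ua≡ lt
    from : ∀ b → IsInv u (a , T b) → IsInv u′ (a , b)
    from b (a<Tb , lt) = subst (a F.<_) (τ-involutive i j b) (τ-preserves i j (a F.<_) i⇒j j⇒i a<Tb)
                       , subst (u ⟨$⟩ʳ T b F.<_) (sym ua≡) lt

  row-between : ∀ a → i F.< a → a F.< j → row u a ℕ.≤ row u′ a
  row-between a i<a a<j = sum-mono-≤ λ b → χ-mono (grow b) _ _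
    where
    grow : ∀ b → IsInv u (a , b) → IsInv u′ (a , b)
    grow b (a<b , ub<ua) with b F.≟ j
    ... | yes refl = a<b , subst₂ F._<_ (sym u′-j) (sym (u′-other (<⇒≢ i<a ∘ sym) (<⇒≢ a<j))) (ℕP.<-trans ui<uj ub<ua)
    ... | no b≢j = a<b , subst₂ F._<_ (sym (u′-other (<⇒≢ (ℕP.<-trans i<a a<b) ∘ sym) b≢j))
                                      (sym (u′-other (<⇒≢ i<a ∘ sym) (<⇒≢ a<j))) ub<ua

  row-other : ∀ a → a ≢ i → a ≢ j → row u a ℕ.≤ row u′ a
  row-other a a≢i a≢j with FP.<-cmp a i | FP.<-cmp a j
  ... | tri≈ _ a≡i _ | _ = ⊥-elim (a≢i a≡i)
  ... | _ | tri≈ _ a≡j _ = ⊥-elim (a≢j a≡j)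
  ... | tri< a<i _ _ | _ = ℕP.≤-reflexive (sym (row-same-side a a≢i a≢j (λ _ → ℕP.<-trans a<i i<j) (λ _ → a<i)))
  ... | tri> _ _ i<a | tri< a<j _ _ = row-between a i<a a<j
  ... | tri> _ _ i<a | tri> _ _ j<a =
    ℕP.≤-reflexive (sym (row-same-side a a≢i a≢j (λ a<i → ⊥-elim (ℕP.<-asym a<i i<a)) (λ a<j → ⊥-elim (ℕP.<-asym a<j j<a))))

  row-i+row-j : row u i + row u j ℕ.< row u′ i + row u′ j
  row-i+row-j = subst₂ ℕ._<_ (∑-distrib-+ (pair u i) (pair u j)) (∑-distrib-+ (pair u′ i) (pair u′ j))
                       (sum-mono-< pointwise j at-j)
    where
    pair : Perm n → Fin n → Fin n → ℕ
    pair v a b = χ (isInv? v (a , b))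
    pair≡0 : ∀ v a b → ¬ IsInv v (a , b) → pair v a b ≡ 0
    pair≡0 v a b ¬inv = χ≡0 ¬inv (isInv? v (a , b))
    pair-mono : ∀ v a b v′ a′ b′ → (IsInv v (a , b) → IsInv v′ (a′ , b′)) → pair v a b ℕ.≤ pair v′ a′ b′
    pair-mono v a b v′ a′ b′ f = χ-mono f (isInv? v (a , b)) (isInv? v′ (a′ , b′))
    zero-below : ∀ b → b F.≤ i → pair u i b + pair u j b ≡ 0
    zero-below b b≤i = cong₂ _+_ (pair≡0 u i b (λ (i<b , _) → ℕP.<-irrefl refl (ℕP.<-≤-trans i<b b≤i)))
                                 (pair≡0 u j b (λ (j<b , _) → ℕP.<-irrefl refl (ℕP.<-≤-trans (ℕP.<-trans i<j j<b) b≤i)))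
    at-j : pair u i j + pair u j j ℕ.< pair u′ i j + pair u′ j j
    at-j = begin-strict
      pair u i j + pair u j j  ≡⟨ cong₂ _+_ (pair≡0 u i j (λ (_ , uj<ui) → ℕP.<-asym uj<ui ui<uj))
                                            (pair≡0 u j j (λ (j<j , _) → ℕP.<-irrefl refl j<j)) ⟩
      0                        <⟨ ℕP.<-≤-trans (χ-< {P = ⊥} (λ ()) (i<j , subst₂ F._<_ (sym u′-j) (sym u′-i) ui<uj) (no (λ ())) (isInv? u′ (i , j)))
                                               (ℕP.m≤m+n _ _) ⟩
      pair u′ i j + pair u′ j j ∎
      where open ℕP.≤-Reasoning
    pointwise : ∀ b → pair u i b + pair u j b ℕ.≤ pair u′ i b + pair u′ j b
    pointwise b with FP.<-cmp b i | FP.<-cmp b j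
    ... | tri< b<i _ _ | _ = ℕP.≤-trans (ℕP.≤-reflexive (zero-below b (ℕP.<⇒≤ b<i))) z≤n
    ... | tri≈ _ refl _ | _ = ℕP.≤-trans (ℕP.≤-reflexive (zero-below b ℕP.≤-refl)) z≤n
    ... | tri> _ _ _ | tri≈ _ refl _ = ℕP.<⇒≤ at-j
    ... | tri> _ _ i<b | tri< b<j _ _ = ℕP.+-mono-≤
      (pair-mono u i b u′ i b (λ (i<b , ub<ui) → i<b , subst₂ F._<_ (sym (u′-other (<⇒≢ i<b ∘ sym) (<⇒≢ b<j))) (sym u′-i)
                                                     (ℕP.<-trans ub<ui ui<uj)))
      (ℕP.≤-trans (ℕP.≤-reflexive (pair≡0 u j b (λ (j<b , _) → ℕP.<-asym j<b b<j))) z≤n)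
    ... | tri> _ _ i<b | tri> _ _ j<b = ℕP.≤-trans
      (ℕP.+-mono-≤ (pair-mono u i b u′ j b (λ (_ , ub<ui) → j<b , subst₂ F._<_ (sym ub≡) (sym u′-j) ub<ui))
                   (pair-mono u j b u′ i b (λ (_ , ub<uj) → i<b , subst₂ F._<_ (sym ub≡) (sym u′-i) ub<uj)))
      (ℕP.≤-reflexive (ℕP.+-comm (pair u′ j b) (pair u′ i b)))
      where
      ub≡ : u′ ⟨$⟩ʳ b ≡ u ⟨$⟩ʳ b
      ub≡ = u′-other (<⇒≢ i<b ∘ sym) (<⇒≢ j<b ∘ sym)

  inversions-< : inversions u ℕ.< inversions u′
  inversions-< = subst₂ ℕ._<_ (sym (inversions≡sum-row u)) (sym (inversions≡sum-row u′))
    (sum-mono-<-at-two i j (<⇒≢ i<j) row-other row-i+row-j)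

open SwapAscent using (inversions-<)

-- The rank criterion for the Bruhat order

⪯-trans : ∀ {n} {u v x : Perm n} → u ⪯ v → v ⪯ x → u ⪯ x
⪯-trans {n} u⪯v (⪯-refl v≈x) = ≈-closure u⪯v v≈x
  where
  ≈-closure : ∀ {u v x : Perm n} → u ⪯ v → v ≈ₚ x → u ⪯ x
  ≈-closure (⪯-refl e) e′ = ⪯-refl (λ a → trans (e a) (e′ a))
  ≈-closure (⪯-step i j d i<j inv e) e′ = ⪯-step i j d i<j inv (λ a → trans (e a) (e′ a))
⪯-trans u⪯v (⪯-step i j d i<j inv e) = ⪯-step i j (⪯-trans u⪯v d) i<j inv e

⪯-swapPos : ∀ {n} (v : Perm n) (i j : Fin n) → i F.< j → v ⟨$⟩ʳ i F.< v ⟨$⟩ʳ j → v ⪯ swapPos v i j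
⪯-swapPos v i j i<j vi<vj = ⪯-step {v = v} i j (⪯-refl (λ _ → refl)) i<j (inversions-< v i j i<j vi<vj) (λ _ → refl)

ascent-of-inversions-< : ∀ {n} (v : Perm n) (i j : Fin n) → i F.< j →
  inversions v ℕ.< inversions (swapPos v i j) → v ⟨$⟩ʳ i F.< v ⟨$⟩ʳ j
ascent-of-inversions-< v i j i<j more with FP.<-cmp (v ⟨$⟩ʳ i) (v ⟨$⟩ʳ j)
... | tri< vi<vj _ _ = vi<vj
... | tri≈ _ vi≡vj _ = ⊥-elim (<⇒≢ i<j (⟨$⟩ʳ-injective v vi≡vj))
... | tri> _ _ vj<vi = ⊥-elim (ℕP.<-asym more
        (subst (inversions v′ ℕ.<_) (inversions-cong {u = swapPos v′ i j} {v} λ a → cong (v ⟨$⟩ʳ_) (τ-involutive i j a))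
          (inversions-< v′ i j i<j (subst₂ F._<_ (sym (cong (v ⟨$⟩ʳ_) (τ-i i j))) (sym (cong (v ⟨$⟩ʳ_) (τ-j i j))) vj<vi))))
  where v′ = swapPos v i j

module _ {n : ℕ} where

  InRank : Perm n → ℕ → ℕ → Fin n → Set
  InRank v x k a = (toℕ a ℕ.< x) × (toℕ (v ⟨$⟩ʳ a) ℕ.< k)

  inRank? : ∀ v x k a → Dec (InRank v x k a)
  inRank? v x k a = (toℕ a ℕ.<? x) ×-dec (toℕ (v ⟨$⟩ʳ a) ℕ.<? k)

  InCorank : Perm n → ℕ → ℕ → Fin n → Set
  InCorank v x k a = (x ℕ.≤ toℕ a) × (toℕ (v ⟨$⟩ʳ a) ℕ.< k)

  inCorank? : ∀ v x k a → Dec (InCorank v x k a)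
  inCorank? v x k a = (x ℕ.≤? toℕ a) ×-dec (toℕ (v ⟨$⟩ʳ a) ℕ.<? k)

  rank : Perm n → ℕ → ℕ → ℕ
  rank v x k = sum λ a → χ (inRank? v x k a)

  corank : Perm n → ℕ → ℕ → ℕ
  corank v x k = sum λ a → χ (inCorank? v x k a)

  -- Rank-matrix domination; by the tableau criterion it coincides with v ⪯ u (⪯⇒⊑, ⊑⇒⪯).
  _⊑_ : Perm n → Perm n → Set
  v ⊑ u = ∀ x k → rank u x k ℕ.≤ rank v x k

  rank-cong : ∀ {u v} → u ≈ₚ v → ∀ x k → rank u x k ≡ rank v x k
  rank-cong u≈v x k = sum-cong-≗ λ a → cong (λ c → χ ((toℕ a ℕ.<? x) ×-dec (toℕ c ℕ.<? k))) (u≈v a)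

  rank+corank : ∀ v x k → rank v x k + corank v x k ≡ sum λ a → χ (toℕ (v ⟨$⟩ʳ a) ℕ.<? k)
  rank+corank v x k = trans (sym (∑-distrib-+ (λ a → χ (inRank? v x k a)) (λ a → χ (inCorank? v x k a))))
    (sum-cong-≗ {n} λ a → sym (χ-⊎ (cases (toℕ a ℕ.<? x)) proj₂ proj₂
      (λ (a<x , _) (x≤a , _) → ℕP.<-irrefl refl (ℕP.<-≤-trans a<x x≤a))
      (toℕ (v ⟨$⟩ʳ a) ℕ.<? k) (inRank? v x k a) (inCorank? v x k a)))
    where
    cases : ∀ {a} {P : Set} → Dec (a ℕ.< x) → P → ((a ℕ.< x) × P) ⊎ ((x ℕ.≤ a) × P)
    cases (yes a<x) p = inj₁ (a<x , p)
    cases (no a≮x) p = inj₂ (ℕP.≮⇒≥ a≮x , p)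

  -- Both sides count the values below k.
  rank+corank-invariant : ∀ u v x k → rank u x k + corank u x k ≡ rank v x k + corank v x k
  rank+corank-invariant u v x k = begin
    rank u x k + corank u x k                   ≡⟨ rank+corank u x k ⟩
    sum (λ a → χ (toℕ (u ⟨$⟩ʳ a) ℕ.<? k))       ≡⟨ sum-reindex (λ c → χ (toℕ c ℕ.<? k)) u ⟩
    sum {n} (λ c → χ (toℕ c ℕ.<? k))            ≡⟨ sum-reindex (λ c → χ (toℕ c ℕ.<? k)) v ⟨
    sum (λ a → χ (toℕ (v ⟨$⟩ʳ a) ℕ.<? k))       ≡⟨ rank+corank v x k ⟨
    rank v x k + corank v x k                   ∎
    where open ≡-Reasoning

  corank≡0-beyond : ∀ v {x} → n ℕ.≤ x → ∀ k → corank v x k ≡ 0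
  corank≡0-beyond v {x} n≤x k = sum-zero λ a →
    χ≡0 (λ (x≤a , _) → ℕP.<-irrefl refl (ℕP.<-≤-trans (FP.toℕ<n a) (ℕP.≤-trans n≤x x≤a))) (inCorank? v x k a)

  rank-full : ∀ u v {x} → n ℕ.≤ x → ∀ k → rank u x k ≡ rank v x k
  rank-full u v {x} n≤x k = ℕP.+-cancelʳ-≡ 0 (rank u x k) (rank v x k)
    (subst₂ (λ c c′ → rank u x k + c ≡ rank v x k + c′) (corank≡0-beyond u n≤x k) (corank≡0-beyond v n≤x k)
            (rank+corank-invariant u v x k))

  corank≤⇒rank≥ : ∀ u v x k → corank v x k ℕ.≤ corank u x k → rank u x k ℕ.≤ rank v x k
  corank≤⇒rank≥ u v x k le = ℕP.+-cancelʳ-≤ (corank v x k) (rank u x k) (rank v x k)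
    (ℕP.≤-trans (ℕP.+-monoʳ-≤ (rank u x k) le) (ℕP.≤-reflexive (rank+corank-invariant u v x k)))

  rank≤⇒corank≥ : ∀ u v x k → rank u x k ℕ.≤ rank v x k → corank v x k ℕ.≤ corank u x k
  rank≤⇒corank≥ u v x k le = ℕP.+-cancelˡ-≤ (rank v x k) (corank v x k) (corank u x k)
    (ℕP.≤-trans (ℕP.≤-reflexive (rank+corank-invariant v u x k)) (ℕP.+-monoˡ-≤ (corank u x k) le))

  module SwapRank (v : Perm n) (i j : Fin n) (i<j : i F.< j) where

    private
      v′ = swapPos v i j

    rank-swapPos-outside : ∀ x k → x ℕ.≤ toℕ i ⊎ toℕ j ℕ.< x → rank v′ x k ≡ rank v x k
    rank-swapPos-outside x k outside = trans
      (sum-cong-≗ {n} λ a → χ-cong (λ (a<x , p) → to a<x , p) (λ (Ta<x , p) → from Ta<x , p)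
                                  (inRank? v′ x k a) (inRank? v x k (τ i j a)))
      (sum-reindex (λ c → χ (inRank? v x k c)) (transpose i j))
      where
      i⇒j : toℕ i ℕ.< x → toℕ j ℕ.< x
      i⇒j i<x = [ (λ x≤i → ⊥-elim (ℕP.<-irrefl refl (ℕP.<-≤-trans i<x x≤i))) , (λ j<x → j<x) ]′ outside
      to : ∀ {a} → toℕ a ℕ.< x → toℕ (τ i j a) ℕ.< x
      to = τ-preserves i j (λ c → toℕ c ℕ.< x) i⇒j (ℕP.<-trans i<j)
      from : ∀ {a} → toℕ (τ i j a) ℕ.< x → toℕ a ℕ.< x
      from {a} Ta<x = subst (λ c → toℕ c ℕ.< x) (τ-involutive i j a) (to Ta<x)

    rank-swapPos-inside : ∀ x k → toℕ i ℕ.< x → x ℕ.≤ toℕ j →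
      rank v x k + χ (toℕ (v ⟨$⟩ʳ j) ℕ.<? k) ≡ rank v′ x k + χ (toℕ (v ⟨$⟩ʳ i) ℕ.<? k)
    rank-swapPos-inside x k i<x x≤j = subst₂ (λ c c′ → rank v x k + c ≡ rank v′ x k + c′)
      (χ-cong (λ (_ , p) → subst (λ c → toℕ (v ⟨$⟩ʳ c) ℕ.< k) (τ-i i j) p)
              (λ p → i<x , subst (λ c → toℕ (v ⟨$⟩ʳ c) ℕ.< k) (sym (τ-i i j)) p) (inRank? v′ x k i) (toℕ (v ⟨$⟩ʳ j) ℕ.<? k))
      (χ-cong proj₂ (i<x ,_) (inRank? v x k i) (toℕ (v ⟨$⟩ʳ i) ℕ.<? k))
      (sum-exchange i agree)
      where
      j≮x : ∀ {P : Set} → ¬ ((toℕ j ℕ.< x) × P)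
      j≮x (j<x , _) = ℕP.<-irrefl refl (ℕP.<-≤-trans j<x x≤j)
      agree : ∀ a → a ≢ i → χ (inRank? v x k a) ≡ χ (inRank? v′ x k a)
      agree a a≢i with a F.≟ j
      ... | yes refl = trans (χ≡0 j≮x (inRank? v x k a)) (sym (χ≡0 j≮x (inRank? v′ x k a)))
      ... | no a≢j = cong (λ c → χ ((toℕ a ℕ.<? x) ×-dec (toℕ (v ⟨$⟩ʳ c) ℕ.<? k))) (sym (τ-other i j a≢i a≢j))

    InRectangle : ℕ → ℕ → Set
    InRectangle x k = (toℕ i ℕ.< x) × (x ℕ.≤ toℕ j) × (toℕ (v ⟨$⟩ʳ i) ℕ.< k) × (k ℕ.≤ toℕ (v ⟨$⟩ʳ j))

    inRectangle? : ∀ x k → Dec (InRectangle x k)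
    inRectangle? x k = (toℕ i ℕ.<? x) ×-dec (x ℕ.≤? toℕ j) ×-dec (toℕ (v ⟨$⟩ʳ i) ℕ.<? k) ×-dec (k ℕ.≤? toℕ (v ⟨$⟩ʳ j))

    private
      outside : ∀ {x k} → x ℕ.≤ toℕ i ⊎ toℕ j ℕ.< x → ¬ InRectangle x k → rank v x k ≡ rank v′ x k + χ (inRectangle? x k)
      outside {x} {k} out ¬rect = begin
        rank v x k                          ≡⟨ rank-swapPos-outside x k out ⟨
        rank v′ x k                         ≡⟨ ℕP.+-identityʳ _ ⟨
        rank v′ x k + 0                     ≡⟨ cong (rank v′ x k +_) (χ≡0 ¬rect (inRectangle? x k)) ⟨
        rank v′ x k + χ (inRectangle? x k)  ∎
        where open ≡-Reasoning

    rank-swapPos-ascent : v ⟨$⟩ʳ i F.< v ⟨$⟩ʳ j → ∀ x k → rank v x k ≡ rank v′ x k + χ (inRectangle? x k)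
    rank-swapPos-ascent vi<vj x k with x ℕ.≤? toℕ i | toℕ j ℕ.<? x
    ... | yes x≤i | _ = outside (inj₁ x≤i) (λ (i<x , _) → ℕP.<-irrefl refl (ℕP.<-≤-trans i<x x≤i))
    ... | no _ | yes j<x = outside (inj₂ j<x) (λ (_ , x≤j , _) → ℕP.<-irrefl refl (ℕP.<-≤-trans j<x x≤j))
    ... | no x≰i | no j≮x = ℕP.+-cancelʳ-≡ (χ (toℕ (v ⟨$⟩ʳ j) ℕ.<? k)) (rank v x k) (rank v′ x k + χ (inRectangle? x k)) (begin
      rank v x k + χ (vj<? k)                               ≡⟨ rank-swapPos-inside x k i<x x≤j ⟩
      rank v′ x k + χ (vi<? k)                              ≡⟨ cong (rank v′ x k +_) split ⟩
      rank v′ x k + (χ (inRectangle? x k) + χ (vj<? k))     ≡⟨ ℕP.+-assoc (rank v′ x k) _ _ ⟨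
      rank v′ x k + χ (inRectangle? x k) + χ (vj<? k)       ∎)
      where
      open ≡-Reasoning
      i<x = ℕP.≰⇒> x≰i
      x≤j = ℕP.≮⇒≥ j≮x
      vi<? : ∀ k → Dec (toℕ (v ⟨$⟩ʳ i) ℕ.< k)
      vi<? k = toℕ (v ⟨$⟩ʳ i) ℕ.<? k
      vj<? : ∀ k → Dec (toℕ (v ⟨$⟩ʳ j) ℕ.< k)
      vj<? k = toℕ (v ⟨$⟩ʳ j) ℕ.<? k
      cases : toℕ (v ⟨$⟩ʳ i) ℕ.< k → InRectangle x k ⊎ toℕ (v ⟨$⟩ʳ j) ℕ.< k
      cases vi<k with toℕ (v ⟨$⟩ʳ j) ℕ.<? k
      ... | yes vj<k = inj₂ vj<k
      ... | no vj≮k = inj₁ (i<x , x≤j , vi<k , ℕP.≮⇒≥ vj≮k)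
      split : χ (vi<? k) ≡ χ (inRectangle? x k) + χ (vj<? k)
      split = χ-⊎ cases (λ (_ , _ , vi<k , _) → vi<k) (ℕP.<-trans vi<vj)
                  (λ (_ , _ , _ , k≤vj) vj<k → ℕP.<-irrefl refl (ℕP.<-≤-trans vj<k k≤vj))
                  (vi<? k) (inRectangle? x k) (vj<? k)

  ⊑-swapPos : ∀ u v i j → (i<j : i F.< j) → v ⟨$⟩ʳ i F.< v ⟨$⟩ʳ j → v ⊑ u →
    (∀ x k → SwapRank.InRectangle v i j i<j x k → rank u x k ℕ.< rank v x k) → swapPos v i j ⊑ u
  ⊑-swapPos u v i j i<j vi<vj v⊑u strict x k
    with SwapRank.inRectangle? v i j i<j x k | SwapRank.rank-swapPos-ascent v i j i<j vi<vj x k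
  ... | yes rect | v≡ = ℕP.≤-pred (ℕP.<-≤-trans (strict x k rect) (ℕP.≤-reflexive (trans v≡ (ℕP.+-comm _ 1))))
  ... | no _ | v≡ = ℕP.≤-trans (v⊑u x k) (ℕP.≤-reflexive (trans v≡ (ℕP.+-identityʳ _)))

  ⪯⇒⊑ : ∀ {v u} → v ⪯ u → v ⊑ u
  ⪯⇒⊑ {v} {u} (⪯-refl v≈u) x k = ℕP.≤-reflexive (sym (rank-cong {v} {u} v≈u x k))
  ⪯⇒⊑ {v} (⪯-step {v = w} {x = t} i j v⪯w i<j more w′≈t) x k = begin
    rank t x k                                     ≡⟨ rank-cong {swapPos w i j} {t} w′≈t x k ⟨
    rank (swapPos w i j) x k                       ≤⟨ ℕP.m≤m+n _ _ ⟩
    rank (swapPos w i j) x k + χ (inRectangle? x k) ≡⟨ rank-swapPos-ascent (ascent-of-inversions-< w i j i<j more) x k ⟨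
    rank w x k                                     ≤⟨ ⪯⇒⊑ v⪯w x k ⟩
    rank v x k                                     ∎
    where
    open ℕP.≤-Reasoning
    open SwapRank w i j i<j

  RankBetween : Perm n → ℕ → ℕ → ℕ → Fin n → Set
  RankBetween w y x k a = (y ℕ.≤ toℕ a) × (toℕ a ℕ.< x) × (toℕ (w ⟨$⟩ʳ a) ℕ.< k)

  rankBetween? : ∀ w y x k a → Dec (RankBetween w y x k a)
  rankBetween? w y x k a = (y ℕ.≤? toℕ a) ×-dec (toℕ a ℕ.<? x) ×-dec (toℕ (w ⟨$⟩ʳ a) ℕ.<? k)

  rankBetween : Perm n → ℕ → ℕ → ℕ → ℕ
  rankBetween w y x k = sum λ a → χ (rankBetween? w y x k a)

  rank-split : ∀ w {y x} k → y ℕ.≤ x → rank w x k ≡ rank w y k + rankBetween w y x k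
  rank-split w {y} {x} k y≤x = trans
    (sum-cong-≗ {n} λ a → χ-⊎ (cases (toℕ a ℕ.<? y)) (λ (a<y , p) → ℕP.<-≤-trans a<y y≤x , p) (λ (_ , a<x , p) → a<x , p)
      (λ (a<y , _) (y≤a , _) → ℕP.<-irrefl refl (ℕP.<-≤-trans a<y y≤a))
      (inRank? w x k a) (inRank? w y k a) (rankBetween? w y x k a))
    (∑-distrib-+ (λ a → χ (inRank? w y k a)) (λ a → χ (rankBetween? w y x k a)))
    where
    cases : ∀ {a} → Dec (toℕ a ℕ.< y) → InRank w x k a → InRank w y k a ⊎ RankBetween w y x k a
    cases (yes a<y) (_ , p) = inj₁ (a<y , p)
    cases (no a≮y) (a<x , p) = inj₂ (ℕP.≮⇒≥ a≮y , a<x , p)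

  rank-agree : ∀ {u v y} → (∀ c → toℕ c ℕ.< y → v ⟨$⟩ʳ c ≡ u ⟨$⟩ʳ c) → ∀ k → rank v y k ≡ rank u y k
  rank-agree {u} {v} {y} agree k = sum-cong-≗ {n} λ a → χ-cong
    (λ (a<y , p) → a<y , subst (λ c → toℕ c ℕ.< k) (agree a a<y) p)
    (λ (a<y , p) → a<y , subst (λ c → toℕ c ℕ.< k) (sym (agree a a<y)) p) (inRank? v y k a) (inRank? u y k a)

  module Descent (u v : Perm n) (v⊑u : v ⊑ u) (i : Fin n)
                 (agree : ∀ c → c F.< i → v ⟨$⟩ʳ c ≡ u ⟨$⟩ʳ c) (vi<ui : v ⟨$⟩ʳ i F.< u ⟨$⟩ʳ i) where

    private
      V U : Fin n → ℕ
      V a = toℕ (v ⟨$⟩ʳ a)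
      U a = toℕ (u ⟨$⟩ʳ a)

    Candidate : Fin n → Set
    Candidate b = (i F.< b) × (V i ℕ.< V b) × (V b ℕ.≤ U i)

    candidate? : ∀ b → Dec (Candidate b)
    candidate? b = (i F.<? b) ×-dec (V i ℕ.<? V b) ×-dec (V b ℕ.≤? U i)

    -- Since v and u agree before i, the value u i sits in v after position i.
    candidate-v⁻¹ui : Candidate (v ⟨$⟩ˡ (u ⟨$⟩ʳ i))
    candidate-v⁻¹ui = i<q , subst (λ c → V i ℕ.< toℕ c) (sym vq≡ui) vi<ui , ℕP.≤-reflexive (cong toℕ vq≡ui)
      where
      q = v ⟨$⟩ˡ (u ⟨$⟩ʳ i)
      vq≡ui : v ⟨$⟩ʳ q ≡ u ⟨$⟩ʳ i
      vq≡ui = inverseʳ v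
      i<q : i F.< q
      i<q with FP.<-cmp q i
      ... | tri< q<i _ _ = ⊥-elim (<⇒≢ q<i (⟨$⟩ʳ-injective u (trans (sym (agree q q<i)) vq≡ui)))
      ... | tri≈ _ q≡i _ = ⊥-elim (<⇒≢ vi<ui (subst (λ c → v ⟨$⟩ʳ c ≡ u ⟨$⟩ʳ i) q≡i vq≡ui))
      ... | tri> _ _ i<q = i<q

    j : Fin n
    j = proj₁ (least candidate? _ candidate-v⁻¹ui)

    j-candidate : Candidate j
    j-candidate = proj₁ (proj₂ (least candidate? _ candidate-v⁻¹ui))

    j-least : ∀ c → c F.< j → ¬ Candidate c
    j-least = proj₂ (proj₂ (least candidate? _ candidate-v⁻¹ui))

    i<j : i F.< j
    i<j = proj₁ j-candidate

    vi<vj : v ⟨$⟩ʳ i F.< v ⟨$⟩ʳ j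
    vi<vj = proj₁ (proj₂ j-candidate)

    private
      k≤ui : ∀ {k} → k ℕ.≤ V j → k ℕ.≤ U i
      k≤ui k≤vj = ℕP.≤-trans k≤vj (proj₂ (proj₂ j-candidate))

    -- By minimality of j, no value of v on (i, x) lies in (v i, u i].
    rankBetween-v : ∀ x k → x ℕ.≤ toℕ j → V i ℕ.< k → k ℕ.≤ V j →
      rankBetween v (toℕ i) x k ≡ rankBetween v (toℕ i) x (suc (U i))
    rankBetween-v x k x≤j vi<k k≤vj = sum-cong-≗ {n} λ a → χ-cong
      (λ (i≤a , a<x , va<k) → i≤a , a<x , s≤s (ℕP.≤-trans (ℕP.<⇒≤ va<k) (k≤ui k≤vj)))
      (λ (i≤a , a<x , va≤ui) → i≤a , a<x , back a i≤a a<x (ℕP.≤-pred va≤ui))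
      (rankBetween? v (toℕ i) x k a) (rankBetween? v (toℕ i) x (suc (U i)) a)
      where
      back : ∀ a → toℕ i ℕ.≤ toℕ a → toℕ a ℕ.< x → V a ℕ.≤ U i → V a ℕ.< k
      back a i≤a a<x va≤ui with ℕP.m≤n⇒m<n∨m≡n i≤a
      ... | inj₂ i≡a = subst (λ c → V c ℕ.< k) (FP.toℕ-injective i≡a) vi<k
      ... | inj₁ i<a with V i ℕ.<? V a
      ... | yes vi<va = ⊥-elim (j-least a (ℕP.<-≤-trans a<x x≤j) (i<a , vi<va , va≤ui))
      ... | no vi≮va = ℕP.≤-<-trans (ℕP.≮⇒≥ vi≮va) vi<k

    rankBetween-u : ∀ x k → toℕ i ℕ.< x → k ℕ.≤ V j →
      rankBetween u (toℕ i) x k ℕ.< rankBetween u (toℕ i) x (suc (U i))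
    rankBetween-u x k i<x k≤vj = sum-mono-<
      (λ a → χ-mono (λ (i≤a , a<x , ua<k) → i≤a , a<x , ℕP.<-≤-trans ua<k (ℕP.≤-trans (k≤ui k≤vj) (ℕP.n≤1+n _)))
                    (rankBetween? u (toℕ i) x k a) (rankBetween? u (toℕ i) x (suc (U i)) a))
      i (χ-< (λ (_ , _ , ui<k) → ℕP.<-irrefl refl (ℕP.<-≤-trans ui<k (k≤ui k≤vj))) (ℕP.≤-refl , i<x , ℕP.≤-refl)
             (rankBetween? u (toℕ i) x k i) (rankBetween? u (toℕ i) x (suc (U i)) i))

    rank-<-on-rectangle : ∀ x k → SwapRank.InRectangle v i j i<j x k → rank u x k ℕ.< rank v x k
    rank-<-on-rectangle x k (i<x , x≤j , vi<k , k≤vj) = begin-strict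
      rank u x k                                      ≡⟨ rank-split u k i≤x ⟩
      rank u (toℕ i) k + rankBetween u (toℕ i) x k    <⟨ ℕP.+-monoʳ-< _ (rankBetween-u x k i<x k≤vj) ⟩
      rank u (toℕ i) k + rankBetween u (toℕ i) x k′   ≤⟨ ℕP.+-monoʳ-≤ _ between-u≤v ⟩
      rank u (toℕ i) k + rankBetween v (toℕ i) x k′   ≡⟨ cong₂ _+_ (rank-agree {u} {v} (λ c → agree c) k) (rankBetween-v x k x≤j vi<k k≤vj) ⟨
      rank v (toℕ i) k + rankBetween v (toℕ i) x k    ≡⟨ rank-split v k i≤x ⟨
      rank v x k                                      ∎
      where
      open ℕP.≤-Reasoning
      i≤x = ℕP.<⇒≤ i<x
      k′ = suc (U i)
      between-u≤v : rankBetween u (toℕ i) x k′ ℕ.≤ rankBetween v (toℕ i) x k′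
      between-u≤v = ℕP.+-cancelˡ-≤ (rank u (toℕ i) k′) _ _ (subst₂ ℕ._≤_ (rank-split u k′ i≤x)
        (trans (rank-split v k′ i≤x) (cong (_+ rankBetween v (toℕ i) x k′) (rank-agree {u} {v} (λ c → agree c) k′)))
        (v⊑u x k′))

    swapPos-⊑ : swapPos v i j ⊑ u
    swapPos-⊑ = ⊑-swapPos u v i j i<j vi<vj v⊑u rank-<-on-rectangle

  first-difference : ∀ (u v : Perm n) → ¬ (∀ a → v ⟨$⟩ʳ a ≡ u ⟨$⟩ʳ a) →
    Σ (Fin n) λ i → v ⟨$⟩ʳ i ≢ u ⟨$⟩ʳ i × (∀ c → c F.< i → v ⟨$⟩ʳ c ≡ u ⟨$⟩ʳ c)
  first-difference u v v≢u with FP.¬∀⟶∃¬ n _ (λ a → v ⟨$⟩ʳ a F.≟ u ⟨$⟩ʳ a) v≢u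
  ... | a , va≢ua with least (λ c → ¬? (v ⟨$⟩ʳ c F.≟ u ⟨$⟩ʳ c)) a va≢ua
  ... | i , vi≢ui , before = i , vi≢ui , λ c c<i → decidable-stable
                                                    (v ⟨$⟩ʳ c F.≟ u ⟨$⟩ʳ c) (before c c<i)

  first-difference-< : ∀ {u v} → v ⊑ u → ∀ i → v ⟨$⟩ʳ i ≢ u ⟨$⟩ʳ i → (∀ c → c F.< i → v ⟨$⟩ʳ c ≡ u ⟨$⟩ʳ c) →
    v ⟨$⟩ʳ i F.< u ⟨$⟩ʳ i
  first-difference-< {u} {v} v⊑u i vi≢ui agree with FP.<-cmp (v ⟨$⟩ʳ i) (u ⟨$⟩ʳ i)
  ... | tri< vi<ui _ _ = vi<ui
  ... | tri≈ _ vi≡ui _ = ⊥-elim (vi≢ui vi≡ui)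
  ... | tri> _ _ ui<vi = ⊥-elim (ℕP.<-irrefl refl (ℕP.<-≤-trans
          (sum-mono-< (λ a → χ-mono (pointwise a) (inRank? v x k a) (inRank? u x k a)) i
                      (χ-< (λ (_ , vi<vi) → ℕP.<-irrefl refl vi<vi) (ℕP.≤-refl , ui<vi) (inRank? v x k i) (inRank? u x k i)))
          (v⊑u x k)))
    where
    x = suc (toℕ i)
    k = toℕ (v ⟨$⟩ʳ i)
    pointwise : ∀ a → InRank v x k a → InRank u x k a
    pointwise a (a<x , va<k) with FP.<-cmp a i
    ... | tri< a<i _ _ = a<x , subst (λ c → toℕ c ℕ.< k) (agree a a<i) va<k
    ... | tri≈ _ refl _ = ⊥-elim (ℕP.<-irrefl refl va<k)
    ... | tri> _ _ i<a = ⊥-elim (ℕP.<-irrefl refl (ℕP.<-≤-trans i<a (ℕP.≤-pred a<x)))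

  ⊑⇒⪯ : ∀ {v u} → v ⊑ u → v ⪯ u
  ⊑⇒⪯ {v} {u} v⊑u = go bound v (ℕP.m≤n+m bound (inversions v)) v⊑u
    where
    bound = length (cartesianProduct (allFin n) (allFin n))
    go : (fuel : ℕ) (v : Perm n) → bound ℕ.≤ inversions v + fuel → v ⊑ u → v ⪯ u
    go fuel v enough v⊑u with FP.all? (λ a → v ⟨$⟩ʳ a F.≟ u ⟨$⟩ʳ a)
    ... | yes v≈u = ⪯-refl v≈u
    ... | no v≉u with first-difference u v v≉u
    ... | i , vi≢ui , agree with first-difference-< {u} {v} v⊑u i vi≢ui agree
    ... | vi<ui with fuel
    ...   | zero = ⊥-elim (ℕP.<-irrefl refl (ℕP.<-≤-trans more
                     (ℕP.≤-trans (inversions≤ v′) (ℕP.≤-trans enough (ℕP.≤-reflexive (ℕP.+-identityʳ _))))))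
      where
      open Descent u v v⊑u i agree vi<ui
      v′ = swapPos v i j
      more = inversions-< v i j i<j vi<vj
    ...   | suc fuel′ = ⪯-trans (⪯-swapPos v i j i<j vi<vj)
                          (go fuel′ (swapPos v i j) (ℕP.≤-trans enough (ℕP.≤-trans
                             (ℕP.≤-reflexive (ℕP.+-suc (inversions v) fuel′)) (ℕP.+-monoˡ-≤ fuel′ more))) swapPos-⊑)
      where
      open Descent u v v⊑u i agree vi<ui
      more = inversions-< v i j i<j vi<vj

n̂ : ∀ {m} → Fin (suc m)
n̂ {m} = fromℕ m

module _ {m : ℕ} where

  ≤m⇒≡n̂ : ∀ {a : Fin (suc m)} → m ℕ.≤ toℕ a → a ≡ n̂
  ≤m⇒≡n̂ {a} m≤a = FP.toℕ-injective (trans (ℕP.≤-antisym (ℕP.≤-pred (FP.toℕ<n a)) m≤a) (sym (FP.toℕ-fromℕ m)))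

  <m⇒≢n̂ : ∀ {a : Fin (suc m)} → toℕ a ℕ.< m → a ≢ n̂
  <m⇒≢n̂ a<m refl = ℕP.<-irrefl (FP.toℕ-fromℕ m) a<m

  ⊑-of-≤-off-last : ∀ {u v : Perm (suc m)} → (∀ a → a ≢ n̂ → v ⟨$⟩ʳ a F.≤ u ⟨$⟩ʳ a) → v ⊑ u
  ⊑-of-≤-off-last {u} {v} v≤u x k with x ℕ.≤? m
  ... | yes x≤m = sum-mono-≤ λ a → χ-mono
          (λ (a<x , ua<k) → a<x , ℕP.≤-<-trans (v≤u a (<m⇒≢n̂ (ℕP.<-≤-trans a<x x≤m))) ua<k)
          (inRank? u x k a) (inRank? v x k a)
  ... | no x≰m = ℕP.≤-reflexive (rank-full u v (ℕP.≰⇒> x≰m) k)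

  1≤corank : ∀ (u : Perm (suc m)) {x k} → x ℕ.≤ m → toℕ (u ⟨$⟩ʳ n̂) ℕ.< k → 1 ℕ.≤ corank u x k
  1≤corank u {x} {k} x≤m un̂<k = ℕP.≤-trans
    (ℕP.≤-reflexive (sym (χ≡1 (subst (x ℕ.≤_) (sym (FP.toℕ-fromℕ m)) x≤m , un̂<k) (inCorank? u x k n̂))))
    (term≤sum (λ a → χ (inCorank? u x k a)) n̂)

  corank-last≡0 : ∀ (u : Perm (suc m)) {k} → k ℕ.≤ toℕ (u ⟨$⟩ʳ n̂) → corank u m k ≡ 0
  corank-last≡0 u {k} k≤un̂ = sum-zero λ a → χ≡0
    (λ (m≤a , ua<k) → ℕP.<-irrefl refl (ℕP.<-≤-trans ua<k (subst (λ c → k ℕ.≤ toℕ (u ⟨$⟩ʳ c)) (sym (≤m⇒≡n̂ m≤a)) k≤un̂)))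
    (inCorank? u m k a)

  ⊑⇒last-≥ : ∀ {u v : Perm (suc m)} → u ⊑ v → v ⟨$⟩ʳ n̂ F.≤ u ⟨$⟩ʳ n̂
  ⊑⇒last-≥ {u} {v} u⊑v = ℕP.≮⇒≥ λ un̂<vn̂ → ℕP.<-irrefl (sym (corank-last≡0 v un̂<vn̂))
    (ℕP.≤-trans (1≤corank u ℕP.≤-refl ℕP.≤-refl) (rank≤⇒corank≥ v u m _ (u⊑v m _)))

  ⊑⇒⁻¹zero-≤ : ∀ {u v : Perm (suc m)} → u ⊑ v → u ⟨$⟩ˡ F.zero F.≤ v ⟨$⟩ˡ F.zero
  ⊑⇒⁻¹zero-≤ {u} {v} u⊑v = ℕP.≮⇒≥ λ v⁻¹0<u⁻¹0 → ℕP.<-irrefl (sym (rank-u≡0 v⁻¹0<u⁻¹0))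
    (ℕP.≤-trans (ℕP.≤-trans (ℕP.≤-reflexive (sym (χ≡1 (ℕP.≤-refl , v[v⁻¹0]<1) (inRank? v x 1 (v ⟨$⟩ˡ F.zero)))))
                            (term≤sum (λ a → χ (inRank? v x 1 a)) (v ⟨$⟩ˡ F.zero)))
                (u⊑v x 1))
    where
    x = suc (toℕ (v ⟨$⟩ˡ F.zero))
    v[v⁻¹0]<1 : toℕ (v ⟨$⟩ʳ (v ⟨$⟩ˡ F.zero)) ℕ.< 1
    v[v⁻¹0]<1 = subst (λ c → toℕ c ℕ.< 1) (sym (inverseʳ v)) (s≤s z≤n)
    rank-u≡0 : v ⟨$⟩ˡ F.zero F.< u ⟨$⟩ˡ F.zero → rank u x 1 ≡ 0
    rank-u≡0 v⁻¹0<u⁻¹0 = sum-zero λ a → χ≡0 (λ (a<x , ua<1) →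
      ℕP.<-irrefl refl (ℕP.<-≤-trans v⁻¹0<u⁻¹0 (ℕP.≤-pred (subst (λ c → toℕ c ℕ.< x)
        (trans (sym (inverseˡ u)) (cong (u ⟨$⟩ˡ_) (FP.toℕ-injective (ℕP.n<1⇒n≡0 ua<1)))) a<x))))
      (inRank? u x 1 a)

cycle : ∀ {n} → Fin n → List (Fin n) → Fin n → Fin n
cycle x [] c = c
cycle x (y ∷ ys) c = cycle x ys (τ x y c)

foldl-swapVal : ∀ {n} (x : Fin n) ys (v : Perm n) a →
  foldl (λ v y → swapVal x y v) v ys ⟨$⟩ʳ a ≡ cycle x ys (v ⟨$⟩ʳ a)
foldl-swapVal x [] v a = refl
foldl-swapVal x (y ∷ ys) v a = foldl-swapVal x ys (swapVal x y v) a

module _ {n : ℕ} where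

  Sorted : List (Fin n) → Set
  Sorted = AllPairs F._<_

  private
    <-irrefl : ∀ {a : Fin n} → ¬ (a F.< a)
    <-irrefl = ℕP.<-irrefl refl

    drop-second : ∀ {x y : Fin n} {ys} → Sorted (x ∷ y ∷ ys) → Sorted (x ∷ ys)
    drop-second ((_ ∷ x<ys) ∷ (_ ∷ ys-sorted)) = x<ys ∷ ys-sorted

    ∈-drop-second : ∀ {x y e : Fin n} {ys} → e ∈ x ∷ y ∷ ys → e ≢ y → e ∈ x ∷ ys
    ∈-drop-second (here e≡x) _ = here e≡x
    ∈-drop-second (there (here e≡y)) e≢y = ⊥-elim (e≢y e≡y)
    ∈-drop-second (there (there e∈ys)) _ = there e∈ys

    ∈-add-second : ∀ {x y e : Fin n} {ys} → e ∈ x ∷ ys → e ∈ x ∷ y ∷ ys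
    ∈-add-second (here e≡x) = here e≡x
    ∈-add-second (there e∈ys) = there (there e∈ys)

    ∈⇒≤-second : ∀ {x y e : Fin n} {ys} → Sorted (x ∷ y ∷ ys) → e ∈ x ∷ y ∷ ys → e ≢ x → y F.≤ e
    ∈⇒≤-second _ (here e≡x) e≢x = ⊥-elim (e≢x e≡x)
    ∈⇒≤-second _ (there (here refl)) _ = ℕP.≤-refl
    ∈⇒≤-second (_ ∷ (y<ys ∷ _)) (there (there e∈ys)) _ = ℕP.<⇒≤ (All.lookup y<ys e∈ys)

  cycle-fixes : ∀ x ys {c} → Sorted (x ∷ ys) → c ∉ x ∷ ys → cycle x ys c ≡ c
  cycle-fixes x [] _ _ = refl
  cycle-fixes x (y ∷ ys) {c} sorted c∉ = begin
    cycle x ys (τ x y c)   ≡⟨ cong (cycle x ys) (τ-other x y (c∉ ∘ here) (c∉ ∘ there ∘ here)) ⟩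
    cycle x ys c           ≡⟨ cycle-fixes x ys (drop-second sorted) (c∉ ∘ ∈-add-second) ⟩
    c                      ∎
    where open ≡-Reasoning

  cycle-next : ∀ x ys {c d} → Sorted (x ∷ ys) → c ∈ x ∷ ys → d ∈ x ∷ ys → c F.< d →
    (∀ {e} → e ∈ x ∷ ys → c F.< e → d F.≤ e) → cycle x ys c ≡ d
  cycle-next x [] _ (here refl) (here refl) c<d _ = ⊥-elim (<-irrefl c<d)
  cycle-next x (y ∷ ys) {c} {d} sorted@((x<y ∷ _) ∷ (y<ys ∷ _)) c∈ d∈ c<d least = cases (c F.≟ x) (c F.≟ y)
   where
   cases : Dec (c ≡ x) → Dec (c ≡ y) → cycle x ys (τ x y c) ≡ d
   cases (yes refl) _ = begin
     cycle x ys (τ x y x)   ≡⟨ cong (cycle x ys) (τ-i x y) ⟩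
     cycle x ys y           ≡⟨ cycle-fixes x ys (drop-second sorted) y∉ ⟩
     y                      ≡⟨ FP.≤-antisym (least (there (here refl)) x<y) (∈⇒≤-second sorted d∈ (<⇒≢ c<d ∘ sym)) ⟨
     d                      ∎
     where
     open ≡-Reasoning
     y∉ : y ∉ x ∷ ys
     y∉ (here refl) = <-irrefl x<y
     y∉ (there y∈ys) = <-irrefl (All.lookup y<ys y∈ys)
   cases (no _) (yes refl) = begin
     cycle x ys (τ x y y)   ≡⟨ cong (cycle x ys) (τ-j x y) ⟩
     cycle x ys x           ≡⟨ cycle-next x ys (drop-second sorted) (here refl)
                                 (∈-drop-second d∈ (<⇒≢ c<d ∘ sym)) (ℕP.<-trans x<y c<d) least′ ⟩
     d                      ∎
     where
     open ≡-Reasoning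
     least′ : ∀ {e} → e ∈ x ∷ ys → x F.< e → d F.≤ e
     least′ (here refl) x<x = ⊥-elim (<-irrefl x<x)
     least′ (there e∈ys) _ = least (there (there e∈ys)) (All.lookup y<ys e∈ys)
   cases (no c≢x) (no c≢y) = begin
     cycle x ys (τ x y c)   ≡⟨ cong (cycle x ys) (τ-other x y c≢x c≢y) ⟩
     cycle x ys c           ≡⟨ cycle-next x ys (drop-second sorted) (∈-drop-second c∈ c≢y) (∈-drop-second d∈ d≢y)
                                 c<d (least ∘ ∈-add-second) ⟩
     d                      ∎
     where
     open ≡-Reasoning
     d≢y : d ≢ y
     d≢y refl = ℕP.<-asym c<d (FP.≤∧≢⇒< (∈⇒≤-second sorted c∈ c≢x) (c≢y ∘ sym))

  cycle-max : ∀ x ys {c} → Sorted (x ∷ ys) → c ∈ x ∷ ys → (∀ {e} → e ∈ x ∷ ys → e F.≤ c) → cycle x ys c ≡ x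
  cycle-max x [] _ (here refl) _ = refl
  cycle-max x (y ∷ ys) {c} sorted@((x<y ∷ _) ∷ (y<ys ∷ _)) c∈ greatest = cases (c F.≟ x) (c F.≟ y)
   where
   cases : Dec (c ≡ x) → Dec (c ≡ y) → cycle x ys (τ x y c) ≡ x
   cases (yes refl) _ = ⊥-elim (ℕP.<-irrefl refl (ℕP.<-≤-trans x<y (greatest (there (here refl)))))
   cases (no _) (yes refl) = trans (cong (cycle x ys) (τ-j x y)) (cycle-max x ys (drop-second sorted) (here refl) greatest′)
     where
     greatest′ : ∀ {e} → e ∈ x ∷ ys → e F.≤ x
     greatest′ (here refl) = ℕP.≤-refl
     greatest′ (there e∈ys) = ⊥-elim (ℕP.<-irrefl refl (ℕP.<-≤-trans (All.lookup y<ys e∈ys) (greatest (there (there e∈ys)))))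
   cases (no c≢x) (no c≢y) = trans (cong (cycle x ys) (τ-other x y c≢x c≢y))
     (cycle-max x ys (drop-second sorted) (∈-drop-second c∈ c≢y) (greatest ∘ ∈-add-second))

module WbarValues {m : ℕ} (w : Perm (suc m)) where

  W W⁻¹ : Fin (suc m) → Fin (suc m)
  W a = w ⟨$⟩ʳ a
  W⁻¹ c = w ⟨$⟩ˡ c

  W∘W⁻¹ : ∀ c → W (W⁻¹ c) ≡ c
  W∘W⁻¹ c = inverseʳ w

  W⁻¹∘W : ∀ a → W⁻¹ (W a) ≡ a
  W⁻¹∘W a = inverseˡ w

  zero∈Y : InY w F.zero
  zero∈Y = ℕP.≤-refl , z≤n

  W[n̂]∈Y : InY w (W n̂)
  W[n̂]∈Y = subst (W⁻¹ F.zero F.≤_) (sym (W⁻¹∘W n̂)) (FP.≤fromℕ _) , ℕP.≤-refl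

  -- The values y₁ < ⋯ < y_r that wbar cycles through after y₀ = 1.
  ys : List (Fin (suc m))
  ys = drop 1 (Ylist w)

  Ylist≡ : Ylist w ≡ F.zero ∷ ys
  Ylist≡ = trans Ylist≡zero∷ (cong (F.zero ∷_) (sym (cong (drop 1) Ylist≡zero∷)))
    where Ylist≡zero∷ = LP.filter-accept (inY? w) zero∈Y

  Y-sorted : Sorted (F.zero ∷ ys)
  Y-sorted = subst Sorted Ylist≡ (AllPairsP.filter⁺ (inY? w) (AllPairsP.tabulate⁺-< (λ i<j → i<j)))

  ∈Y⇒InY : ∀ {c} → c ∈ F.zero ∷ ys → InY w c
  ∈Y⇒InY c∈ = proj₂ (MP.∈-filter⁻ (inY? w) (subst (_ ∈_) (sym Ylist≡) c∈))

  InY⇒∈Y : ∀ {c} → InY w c → c ∈ F.zero ∷ ys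
  InY⇒∈Y c∈Y = subst (_ ∈_) Ylist≡ (MP.∈-filter⁺ (inY? w) (MP.∈-allFin _) c∈Y)

  wbar-apply : ∀ a → wbar w ⟨$⟩ʳ a ≡ cycle F.zero ys (W a)
  wbar-apply a = foldl-swapVal F.zero ys w a

  SuccY : Fin (suc m) → Fin (suc m) → Set
  SuccY c d = InY w d × (c F.< d) × (∀ e → InY w e → c F.< e → d F.≤ e)

  SuccY-exists : ∀ {c} → c F.< W n̂ → Σ (Fin (suc m)) (SuccY c)
  SuccY-exists {c} c<top with least (λ e → inY? w e ×-dec (c F.<? e)) (W n̂) (W[n̂]∈Y , c<top)
  ... | d , (d∈Y , c<d) , below-d = d , d∈Y , c<d , λ e e∈Y c<e → ℕP.≮⇒≥ λ e<d → below-d e e<d (e∈Y , c<e)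

  wbar-n̂ : wbar w ⟨$⟩ʳ n̂ ≡ F.zero
  wbar-n̂ = trans (wbar-apply n̂) (cycle-max F.zero ys Y-sorted (InY⇒∈Y W[n̂]∈Y) (proj₂ ∘ ∈Y⇒InY))

  wbar-∉Y : ∀ a → ¬ InY w (W a) → wbar w ⟨$⟩ʳ a ≡ W a
  wbar-∉Y a W[a]∉Y = trans (wbar-apply a) (cycle-fixes F.zero ys Y-sorted (W[a]∉Y ∘ ∈Y⇒InY))

  W<W[n̂] : ∀ a → InY w (W a) → a ≢ n̂ → W a F.< W n̂
  W<W[n̂] a W[a]∈Y a≢n̂ = FP.≤∧≢⇒< (proj₂ W[a]∈Y) (λ Wa≡ → a≢n̂ (⟨$⟩ʳ-injective w Wa≡))

  wbar-∈Y : ∀ a → InY w (W a) → a ≢ n̂ → Σ (Fin (suc m)) λ d → SuccY (W a) d × (wbar w ⟨$⟩ʳ a ≡ d)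
  wbar-∈Y a W[a]∈Y a≢n̂ with SuccY-exists (W<W[n̂] a W[a]∈Y a≢n̂)
  ... | d , succ@(d∈Y , W[a]<d , least-d) = d , succ ,
    trans (wbar-apply a) (cycle-next F.zero ys Y-sorted (InY⇒∈Y W[a]∈Y) (InY⇒∈Y d∈Y) W[a]<d
                           (λ e∈ → least-d _ (∈Y⇒InY e∈)))

  W≤wbar : ∀ a → a ≢ n̂ → W a F.≤ wbar w ⟨$⟩ʳ a
  W≤wbar a a≢n̂ with inY? w (W a)
  ... | no W[a]∉Y = ℕP.≤-reflexive (cong toℕ (sym (wbar-∉Y a W[a]∉Y)))
  ... | yes W[a]∈Y with wbar-∈Y a W[a]∈Y a≢n̂
  ...   | d , (_ , W[a]<d , _) , wbar[a]≡d = ℕP.≤-trans (ℕP.<⇒≤ W[a]<d) (ℕP.≤-reflexive (cong toℕ (sym wbar[a]≡d)))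

  ∉Y⇒before-one : ∀ {c} → ¬ InY w c → c F.≤ W n̂ → W⁻¹ c F.< W⁻¹ F.zero
  ∉Y⇒before-one c∉Y c≤top = ℕP.≰⇒> λ one≤c → c∉Y (one≤c , c≤top)

-- (1) w̄ is a generator

module _ {m : ℕ} (h : Fin (suc m) → Fin (suc m)) (w : Perm (suc m))
         (hess : IsHessenberg h) (gen : IsGenerator h w) (wo : IsWellOrganized w) where

  open WbarValues w

  private
    h-mono = proj₁ hess
    h-extensive = proj₂ hess
    w-wellOrganized = proj₁ wo

  ≤h-of-top : ∀ i q → n̂ F.≤ h i → q F.≤ h i
  ≤h-of-top i q n̂≤hi = ℕP.≤-trans (ℕP.≤-pred (FP.toℕ<n q)) (subst (ℕ._≤ toℕ (h i)) (FP.toℕ-fromℕ m) n̂≤hi)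

  generator-at : ∀ a d → toℕ d ≡ suc (toℕ (W a)) → W⁻¹ d F.≤ h a
  generator-at a d d≡ = subst (λ c → W⁻¹ c F.≤ h a) (FP.toℕ-injective (trans (FP.toℕ-fromℕ< p) (sym d≡))) (gen a p)
    where
    p : suc (toℕ (W a)) ℕ.< suc m
    p = subst (ℕ._< suc m) d≡ (FP.toℕ<n d)

  -- The gap (c, d) between consecutive elements of Y holds values placed before w⁻¹(1),
  -- so the generator property at the position of d - 1 transfers to w⁻¹(c) by monotonicity of h.
  generator-SuccY : ∀ c d → InY w c → SuccY c d → W⁻¹ d F.≤ h (W⁻¹ c)
  generator-SuccY c F.zero c∈Y (_ , () , _)
  generator-SuccY c (F.suc d′) c∈Y (d∈Y , c<d , least-d) = cases (c F.≟ f)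
    where
    f = F.inject₁ d′
    f≡d′ : toℕ f ≡ toℕ d′
    f≡d′ = FP.toℕ-inject₁ d′
    gen-f : W⁻¹ (F.suc d′) F.≤ h (W⁻¹ f)
    gen-f = generator-at (W⁻¹ f) (F.suc d′) (cong suc (trans (sym f≡d′) (cong toℕ (sym (W∘W⁻¹ f)))))
    f<d : f F.< F.suc d′
    f<d = subst (ℕ._< suc (toℕ d′)) (sym f≡d′) ℕP.≤-refl
    cases : Dec (c ≡ f) → W⁻¹ (F.suc d′) F.≤ h (W⁻¹ c)
    cases (yes refl) = gen-f
    cases (no c≢f) = ℕP.≤-trans gen-f (h-mono (W⁻¹ f) (W⁻¹ c) (ℕP.<⇒≤ (ℕP.<-≤-trans f-before-one (proj₁ c∈Y))))
      where
      c<f : c F.< f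
      c<f = FP.≤∧≢⇒< (subst (toℕ c ℕ.≤_) (sym f≡d′) (ℕP.≤-pred c<d)) c≢f
      f-before-one : W⁻¹ f F.< W⁻¹ F.zero
      f-before-one = ∉Y⇒before-one (λ f∈Y → ℕP.<-irrefl refl (ℕP.<-≤-trans f<d (least-d f f∈Y c<f)))
                                   (ℕP.≤-trans (ℕP.<⇒≤ f<d) (proj₂ d∈Y))

  private
    ≢n̂-of-wbar-suc : ∀ {q k} → toℕ (wbar w ⟨$⟩ʳ q) ≡ suc k → q ≢ n̂
    ≢n̂-of-wbar-suc wbar[q]≡ refl = ℕP.0≢1+n (trans (cong toℕ (sym wbar-n̂)) wbar[q]≡)

    W-of-∉Y : ∀ {q} → ¬ InY w (W q) → W⁻¹ (wbar w ⟨$⟩ʳ q) ≡ q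
    W-of-∉Y {q} W[q]∉Y = trans (cong W⁻¹ (wbar-∉Y q W[q]∉Y)) (W⁻¹∘W q)

  wbar-generator-∉Y : ∀ i q → ¬ InY w (W i) → toℕ (wbar w ⟨$⟩ʳ q) ≡ suc (toℕ (W i)) → q F.≤ h i
  wbar-generator-∉Y i q W[i]∉Y wbar[q]≡ with inY? w (W q)
  ... | no W[q]∉Y = subst (F._≤ h i) (W-of-∉Y W[q]∉Y) gen-i
    where gen-i = generator-at i (wbar w ⟨$⟩ʳ q) wbar[q]≡
  ... | yes W[q]∈Y with wbar-∈Y q W[q]∈Y (≢n̂-of-wbar-suc wbar[q]≡)
  ...   | d , (d∈Y , W[q]<d , _) , wbar[q]≡d = ℕP.<⇒≤ (ℕP.<-≤-trans q<W⁻¹d gen-i)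
    where
    gen-i : W⁻¹ d F.≤ h i
    gen-i = generator-at i d (trans (cong toℕ (sym wbar[q]≡d)) wbar[q]≡)
    q<W⁻¹d : q F.< W⁻¹ d
    q<W⁻¹d = subst (F._< W⁻¹ d) (W⁻¹∘W q) (w-wellOrganized (W q) d W[q]∈Y d∈Y W[q]<d)

  wbar-generator-∈Y : ∀ i q → InY w (W i) → i ≢ n̂ → toℕ (wbar w ⟨$⟩ʳ q) ≡ suc (toℕ (wbar w ⟨$⟩ʳ i)) → q F.≤ h i
  wbar-generator-∈Y i q W[i]∈Y i≢n̂ wbar[q]≡ with wbar-∈Y i W[i]∈Y i≢n̂
  ... | e , succ-e@(e∈Y , W[i]<e , least-e) , wbar[i]≡e = cases (inY? w (W q))
    where
    W⁻¹e≤hi : W⁻¹ e F.≤ h i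
    W⁻¹e≤hi = subst (λ a → W⁻¹ e F.≤ h a) (W⁻¹∘W i) (generator-SuccY (W i) e W[i]∈Y succ-e)
    wbar[q]≡e+1 : toℕ (wbar w ⟨$⟩ʳ q) ≡ suc (toℕ e)
    wbar[q]≡e+1 = trans wbar[q]≡ (cong (suc ∘ toℕ) wbar[i]≡e)
    cases : Dec (InY w (W q)) → q F.≤ h i
    cases (no W[q]∉Y) with toℕ (W q) ℕ.≤? toℕ (W n̂)
    ... | yes W[q]≤top = ℕP.≤-trans (ℕP.<⇒≤ (ℕP.<-≤-trans q-before-one one≤i)) (h-extensive i)
      where
      q-before-one : q F.< W⁻¹ F.zero
      q-before-one = subst (F._< W⁻¹ F.zero) (W⁻¹∘W q) (∉Y⇒before-one W[q]∉Y W[q]≤top)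
      one≤i : W⁻¹ F.zero F.≤ i
      one≤i = subst (W⁻¹ F.zero F.≤_) (W⁻¹∘W i) (proj₁ W[i]∈Y)
    ... | no W[q]≰top = ≤h-of-top i q (subst (F._≤ h i) (trans (cong W⁻¹ e≡top) (W⁻¹∘W n̂)) W⁻¹e≤hi)
      where
      e≡top : e ≡ W n̂
      e≡top = FP.≤-antisym (proj₂ e∈Y)
        (ℕP.≤-pred (subst (toℕ (W n̂) ℕ.<_) (trans (cong toℕ (sym (wbar-∉Y q W[q]∉Y))) wbar[q]≡e+1) (ℕP.≰⇒> W[q]≰top)))
    cases (yes W[q]∈Y) with wbar-∈Y q W[q]∈Y (≢n̂-of-wbar-suc wbar[q]≡)
    ... | d , (_ , W[q]<d , least-d) , wbar[q]≡d = subst (F._≤ h i) (trans (cong W⁻¹ (sym W[q]≡e)) (W⁻¹∘W q)) W⁻¹e≤hi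
      where
      d≡e+1 : toℕ d ≡ suc (toℕ e)
      d≡e+1 = trans (cong toℕ (sym wbar[q]≡d)) wbar[q]≡e+1
      -- W q < e is impossible: e would then lie strictly between W q and its successor d.
      W[q]≡e : W q ≡ e
      W[q]≡e with ℕP.m≤n⇒m<n∨m≡n (ℕP.≤-pred (subst (toℕ (W q) ℕ.<_) d≡e+1 W[q]<d))
      ... | inj₂ W[q]≡e = FP.toℕ-injective W[q]≡e
      ... | inj₁ W[q]<e = ⊥-elim (ℕP.<-irrefl refl (ℕP.<-≤-trans (subst (toℕ e ℕ.<_) (sym d≡e+1) ℕP.≤-refl)
                                                       (least-d e e∈Y W[q]<e)))

  wbar-generator : IsGenerator h (wbar w)
  wbar-generator i p = ≤h (wbar w ⟨$⟩ˡ fromℕ< p) (trans (cong toℕ (inverseʳ (wbar w))) (FP.toℕ-fromℕ< p))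
    where
    ≤h : ∀ q → toℕ (wbar w ⟨$⟩ʳ q) ≡ suc (toℕ (wbar w ⟨$⟩ʳ i)) → q F.≤ h i
    ≤h q wbar[q]≡ with i F.≟ n̂ | inY? w (W i)
    ... | yes refl | _ = ≤h-of-top n̂ q (h-extensive n̂)
    ... | no _ | no W[i]∉Y = wbar-generator-∉Y i q W[i]∉Y (trans wbar[q]≡ (cong (suc ∘ toℕ) (wbar-∉Y i W[i]∉Y)))
    ... | no i≢n̂ | yes W[i]∈Y = wbar-generator-∈Y i q W[i]∈Y i≢n̂ wbar[q]≡

-- (2) The interval [w̄, w₀]

⊑wbar : ∀ {m} (w : Perm (suc m)) → w ⊑ wbar w
⊑wbar w = ⊑-of-≤-off-last {u = wbar w} {v = w} W≤wbar
  where open WbarValues w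

module _ {m : ℕ} (w : Perm (suc m)) (wo : IsWellOrganized w) where

  open WbarValues w

  private
    W⁻¹-mono : ∀ {c d} → InY w c → InY w d → c F.< d → W⁻¹ c F.< W⁻¹ d
    W⁻¹-mono {c} {d} = proj₁ wo c d

  crossing⇒∈Y : ∀ {a k} → toℕ (W a) ℕ.< k → k ℕ.≤ toℕ (wbar w ⟨$⟩ʳ a) → InY w (W a)
  crossing⇒∈Y {a} {k} W[a]<k k≤wbar[a] with inY? w (W a)
  ... | yes W[a]∈Y = W[a]∈Y
  ... | no W[a]∉Y = ⊥-elim (ℕP.<-irrefl refl (ℕP.<-≤-trans W[a]<k (subst (λ c → k ℕ.≤ toℕ c) (wbar-∉Y a W[a]∉Y) k≤wbar[a])))

  -- If b ≠ n, well-organizedness would put W b into Y strictly between W a and its successor.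
  crossing⇒later-below-is-n̂ : ∀ {x k a b} → toℕ a ℕ.< x → toℕ (W a) ℕ.< k → k ℕ.≤ toℕ (wbar w ⟨$⟩ʳ a) →
    x ℕ.≤ toℕ b → toℕ (wbar w ⟨$⟩ʳ b) ℕ.< k → b ≡ n̂
  crossing⇒later-below-is-n̂ {x} {k} {a} {b} a<x W[a]<k k≤wbar[a] x≤b wbar[b]<k with b F.≟ n̂
  ... | yes b≡n̂ = b≡n̂
  ... | no b≢n̂ with wbar-∈Y a (crossing⇒∈Y W[a]<k k≤wbar[a]) (<m⇒≢n̂ (ℕP.<-≤-trans (ℕP.<-≤-trans a<x x≤b) (ℕP.≤-pred (FP.toℕ<n b))))
  ... | e , (e∈Y , W[a]<e , least-e) , wbar[a]≡e = ⊥-elim (compare (FP.<-cmp (W b) (W a)))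
    where
    W[a]∈Y = crossing⇒∈Y W[a]<k k≤wbar[a]
    W[b]<k : toℕ (W b) ℕ.< k
    W[b]<k = ℕP.≤-<-trans (W≤wbar b b≢n̂) wbar[b]<k
    k≤e : k ℕ.≤ toℕ e
    k≤e = subst (λ c → k ℕ.≤ toℕ c) wbar[a]≡e k≤wbar[a]
    a<b : a F.< b
    a<b = ℕP.<-≤-trans a<x x≤b
    W[b]∈Y : InY w (W b)
    W[b]∈Y = subst (W⁻¹ F.zero F.≤_) (sym (W⁻¹∘W b))
               (ℕP.≤-trans (subst (W⁻¹ F.zero F.≤_) (W⁻¹∘W a) (proj₁ W[a]∈Y)) (ℕP.<⇒≤ a<b))
           , ℕP.<⇒≤ (ℕP.<-≤-trans W[b]<k (ℕP.≤-trans k≤e (proj₂ e∈Y)))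
    compare : Tri (W b F.< W a) (W b ≡ W a) (W a F.< W b) → ⊥
    compare (tri< W[b]<W[a] _ _) = ℕP.<-asym a<b (subst₂ F._<_ (W⁻¹∘W b) (W⁻¹∘W a) (W⁻¹-mono W[b]∈Y W[a]∈Y W[b]<W[a]))
    compare (tri≈ _ W[b]≡W[a] _) = <⇒≢ a<b (⟨$⟩ʳ-injective w (sym W[b]≡W[a]))
    compare (tri> _ _ W[a]<W[b]) = ℕP.<-irrefl refl (ℕP.<-≤-trans W[b]<k (ℕP.≤-trans k≤e (least-e (W b) W[b]∈Y W[a]<W[b])))

  ⊑-wbar : ∀ {u} → w ⊑ u → u ⟨$⟩ʳ n̂ ≡ F.zero → wbar w ⊑ u
  ⊑-wbar {u} w⊑u un̂≡0 x k with x ℕ.≤? m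
  ... | no x≰m = ℕP.≤-reflexive (rank-full u (wbar w) (ℕP.≰⇒> x≰m) k)
  ... | yes x≤m with FP.any? (λ a → (toℕ a ℕ.<? x) ×-dec (toℕ (W a) ℕ.<? k) ×-dec (k ℕ.≤? toℕ (wbar w ⟨$⟩ʳ a)))
  ...   | no no-crossing = ℕP.≤-trans (w⊑u x k) (ℕP.≤-reflexive (sum-cong-≗ {suc m} λ a → χ-cong
            (λ (a<x , W[a]<k) → a<x , ℕP.≰⇒> λ k≤wbar[a] → no-crossing (a , a<x , W[a]<k , k≤wbar[a]))
            (λ (a<x , wbar[a]<k) → a<x , ℕP.≤-<-trans (W≤wbar a (<m⇒≢n̂ (ℕP.<-≤-trans a<x x≤m))) wbar[a]<k)
            (inRank? w x k a) (inRank? (wbar w) x k a)))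
  -- A crossing position leaves n as the only late position below k in w̄, and u(n) = 1 is such a position for u.
  ...   | yes (a , a<x , W[a]<k , k≤wbar[a]) = corank≤⇒rank≥ u (wbar w) x k (ℕP.≤-trans
            (sum-mono-≤ λ b → χ-mono (λ (x≤b , wbar[b]<k) → crossing⇒later-below-is-n̂ a<x W[a]<k k≤wbar[a] x≤b wbar[b]<k)
                                     (inCorank? (wbar w) x k b) (b F.≟ n̂))
            (sum-mono-≤ λ b → χ-mono (λ { refl → subst (x ℕ.≤_) (sym (FP.toℕ-fromℕ m)) x≤m
                                                , subst (λ c → toℕ c ℕ.< k) (sym un̂≡0) (ℕP.≤-<-trans z≤n W[a]<k) })
                                     (b F.≟ n̂) (inCorank? u x k b)))

  wbar-interval : ∀ u → InInterval (wbar w) u ⇔ (InInterval w u × (u ⟨$⟩ʳ n̂ ≡ F.zero))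
  wbar-interval u = mk⇔
    (λ (wbar⪯u , u⪯w₀) → (⪯-trans w⪯wbar wbar⪯u , u⪯w₀) , ≤zero (subst (u ⟨$⟩ʳ n̂ F.≤_) wbar-n̂ (⊑⇒last-≥ {u = wbar w} {v = u} (⪯⇒⊑ wbar⪯u))))
    (λ ((w⪯u , u⪯w₀) , un̂≡0) → ⊑⇒⪯ (⊑-wbar {u} (⪯⇒⊑ w⪯u) un̂≡0) , u⪯w₀)
    where
    w⪯wbar : w ⪯ wbar w
    w⪯wbar = ⊑⇒⪯ (⊑wbar w)
    ≤zero : ∀ {c : Fin (suc m)} → c F.≤ F.zero {m} → c ≡ F.zero
    ≤zero {c} c≤0 = FP.toℕ-injective {i = c} {j = F.zero} (ℕP.n≤0⇒n≡0 c≤0)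

  -- (3) The pairs (i, n) in E_{w,h}(w̄)

  -- Strictness comes from the position of the largest element c of Y below k:
  -- w puts c there while wbar puts the successor of c, which is at least k.
  rank-wbar-< : ∀ {i x k} → InY w (W i) → i ≢ n̂ → toℕ i ℕ.< x → x ℕ.≤ m → 1 ℕ.≤ k →
    k ℕ.≤ toℕ (wbar w ⟨$⟩ʳ i) → rank (wbar w) x k ℕ.< rank w x k
  rank-wbar-< {i} {x} {k} W[i]∈Y i≢n̂ i<x x≤m 1≤k k≤wbar[i]
    with wbar-∈Y i W[i]∈Y i≢n̂ | greatest (λ c → inY? w c ×-dec (toℕ c ℕ.<? k)) F.zero (zero∈Y , 1≤k)
  ... | e , (e∈Y , W[i]<e , least-e) , wbar[i]≡e | c , (c∈Y , c<k) , above-c =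
    sum-mono-< (λ b → χ-mono (λ (b<x , wbar[b]<k) → b<x , ℕP.≤-<-trans (W≤wbar b (<m⇒≢n̂ (ℕP.<-≤-trans b<x x≤m))) wbar[b]<k)
                             (inRank? (wbar w) x k b) (inRank? w x k b))
      a (χ-< (λ (_ , wbar[a]<k) → ℕP.<-irrefl refl (ℕP.<-≤-trans wbar[a]<k k≤wbar[a]))
             (a<x , subst (λ d → toℕ d ℕ.< k) (sym (W∘W⁻¹ c)) c<k) (inRank? (wbar w) x k a) (inRank? w x k a))
    where
    a = W⁻¹ c
    k≤e : k ℕ.≤ toℕ e
    k≤e = subst (λ d → k ℕ.≤ toℕ d) wbar[i]≡e k≤wbar[i]
    c≤W[i] : c F.≤ W i
    c≤W[i] = ℕP.≮⇒≥ λ W[i]<c → ℕP.<-irrefl refl (ℕP.<-≤-trans c<k (ℕP.≤-trans k≤e (least-e c c∈Y W[i]<c)))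
    a<x : toℕ a ℕ.< x
    a<x with ℕP.m≤n⇒m<n∨m≡n c≤W[i]
    ... | inj₂ c≡W[i] = subst (λ d → toℕ (W⁻¹ d) ℕ.< x) (sym (FP.toℕ-injective c≡W[i])) (subst (λ d → toℕ d ℕ.< x) (sym (W⁻¹∘W i)) i<x)
    ... | inj₁ c<W[i] = ℕP.<-trans (subst (W⁻¹ c F.<_) (W⁻¹∘W i) (W⁻¹-mono c∈Y W[i]∈Y c<W[i])) i<x
    a≢n̂ : a ≢ n̂
    a≢n̂ a≡n̂ = ℕP.<-irrefl (cong toℕ (trans (sym (W∘W⁻¹ c)) (cong W a≡n̂))) (ℕP.≤-<-trans c≤W[i] (W<W[n̂] i W[i]∈Y i≢n̂))
    k≤wbar[a] : k ℕ.≤ toℕ (wbar w ⟨$⟩ʳ a)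
    k≤wbar[a] with wbar-∈Y a (subst (InY w) (sym (W∘W⁻¹ c)) c∈Y) a≢n̂
    ... | d , (d∈Y , W[a]<d , _) , wbar[a]≡d = subst (λ d′ → k ℕ.≤ toℕ d′) (sym wbar[a]≡d)
          (ℕP.≮⇒≥ λ d<k → above-c d (subst (λ c′ → c′ F.< d) (W∘W⁻¹ c) W[a]<d) (d∈Y , d<k))

  private
    swapPos-wbar-i : ∀ i → swapPos (wbar w) i n̂ ⟨$⟩ʳ i ≡ F.zero
    swapPos-wbar-i i = trans (cong (wbar w ⟨$⟩ʳ_) (τ-i i n̂)) wbar-n̂

    swapPos-wbar-n̂ : ∀ i → swapPos (wbar w) i n̂ ⟨$⟩ʳ n̂ ≡ wbar w ⟨$⟩ʳ i
    swapPos-wbar-n̂ i = cong (wbar w ⟨$⟩ʳ_) (τ-j i n̂)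

  ⊑-swapPos-wbar : ∀ {i} → InY w (W i) → i ≢ n̂ → w ⊑ swapPos (wbar w) i n̂
  ⊑-swapPos-wbar {i} W[i]∈Y i≢n̂ x k = by-cases (inRectangle? x k) (rank-swapPos-ascent v-ascent x k)
    where
    v = swapPos (wbar w) i n̂
    v′ = swapPos v i n̂
    i<n̂ : i F.< n̂
    i<n̂ = FP.≤∧≢⇒< (FP.≤fromℕ i) i≢n̂
    0<wbar[i] : F.zero {m} F.< wbar w ⟨$⟩ʳ i
    0<wbar[i] = ℕP.n≢0⇒n>0 λ wbar[i]≡0 →
      i≢n̂ (⟨$⟩ʳ-injective (wbar w) (trans (FP.toℕ-injective {j = F.zero} wbar[i]≡0) (sym wbar-n̂)))
    v-ascent : v ⟨$⟩ʳ i F.< v ⟨$⟩ʳ n̂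
    v-ascent = subst₂ F._<_ (sym (swapPos-wbar-i i)) (sym (swapPos-wbar-n̂ i)) 0<wbar[i]
    v′≈wbar : ∀ x k → rank v′ x k ≡ rank (wbar w) x k
    v′≈wbar = rank-cong {u = v′} {v = wbar w} λ a → cong (wbar w ⟨$⟩ʳ_) (τ-involutive i n̂ a)
    open SwapRank v i n̂ i<n̂
    by-cases : (d : Dec (InRectangle x k)) → rank v x k ≡ rank v′ x k + χ d → rank v x k ℕ.≤ rank w x k
    by-cases (yes (i<x , x≤n̂ , v[i]<k , k≤v[n̂])) v≡ = begin
      rank v x k                   ≡⟨ v≡ ⟩
      rank v′ x k + 1              ≡⟨ cong (_+ 1) (v′≈wbar x k) ⟩
      rank (wbar w) x k + 1        ≡⟨ ℕP.+-comm _ 1 ⟩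
      suc (rank (wbar w) x k)      ≤⟨ rank-wbar-< W[i]∈Y i≢n̂ i<x (subst (x ℕ.≤_) (FP.toℕ-fromℕ m) x≤n̂)
                                        (subst (λ c → toℕ c ℕ.< k) (swapPos-wbar-i i) v[i]<k)
                                        (subst (λ c → k ℕ.≤ toℕ c) (swapPos-wbar-n̂ i) k≤v[n̂]) ⟩
      rank w x k                   ∎
      where open ℕP.≤-Reasoning
    by-cases (no _) v≡ = begin
      rank v x k                   ≡⟨ v≡ ⟩
      rank v′ x k + 0              ≡⟨ ℕP.+-identityʳ _ ⟩
      rank v′ x k                  ≡⟨ v′≈wbar x k ⟩
      rank (wbar w) x k            ≤⟨ ⊑wbar w x k ⟩
      rank w x k                   ∎
      where open ℕP.≤-Reasoning

  module _ (h : Fin (suc m) → Fin (suc m)) (i : Fin (suc m)) where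

    InE-wbar-n̂⁻ : InE w h (wbar w) i n̂ →
      Σ (Fin (suc m)) λ y → InY w y × (y F.< W n̂) × (i ≡ W⁻¹ y) × (h (W⁻¹ y) ≡ n̂)
    InE-wbar-n̂⁻ (i<n̂ , n̂≤hi , w⪯v) = W i , W[i]∈Y , W<W[n̂] i W[i]∈Y i≢n̂ , sym (W⁻¹∘W i)
                                   , trans (cong h (W⁻¹∘W i)) (≤m⇒≡n̂ (subst (ℕ._≤ toℕ (h i)) (FP.toℕ-fromℕ m) n̂≤hi))
      where
      v = swapPos (wbar w) i n̂
      w⊑v = ⪯⇒⊑ w⪯v
      i≢n̂ : i ≢ n̂
      i≢n̂ refl = ℕP.<-irrefl refl i<n̂
      one≤i : W⁻¹ F.zero F.≤ i
      one≤i = subst (W⁻¹ F.zero F.≤_) (trans (sym (cong (v ⟨$⟩ˡ_) (swapPos-wbar-i i))) (inverseˡ v))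
                    (⊑⇒⁻¹zero-≤ {u = w} {v = v} w⊑v)
      wbar[i]≤top : wbar w ⟨$⟩ʳ i F.≤ W n̂
      wbar[i]≤top = subst (F._≤ W n̂) (swapPos-wbar-n̂ i) (⊑⇒last-≥ {u = w} {v = v} w⊑v)
      W[i]∈Y : InY w (W i)
      W[i]∈Y with inY? w (W i)
      ... | yes W[i]∈Y = W[i]∈Y
      ... | no W[i]∉Y = ⊥-elim (W[i]∉Y (subst (W⁻¹ F.zero F.≤_) (sym (W⁻¹∘W i)) one≤i
                                       , subst (F._≤ W n̂) (wbar-∉Y i W[i]∉Y) wbar[i]≤top))

    InE-wbar-n̂⁺ : Σ (Fin (suc m)) (λ y → InY w y × (y F.< W n̂) × (i ≡ W⁻¹ y) × (h (W⁻¹ y) ≡ n̂)) →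
      InE w h (wbar w) i n̂
    InE-wbar-n̂⁺ (y , y∈Y , y<top , refl , h≡n̂) =
      FP.≤∧≢⇒< (FP.≤fromℕ i) i≢n̂ , ℕP.≤-reflexive (cong toℕ (sym h≡n̂)) , ⊑⇒⪯ (⊑-swapPos-wbar W[i]∈Y i≢n̂)
      where
      W[i]∈Y : InY w (W i)
      W[i]∈Y = subst (InY w) (sym (W∘W⁻¹ y)) y∈Y
      i≢n̂ : i ≢ n̂
      i≢n̂ i≡n̂ = ℕP.<-irrefl (cong toℕ (trans (sym (W∘W⁻¹ y)) (cong W i≡n̂))) y<top

proposition4p2 : (m : ℕ) (h : Fin (suc m) → Fin (suc m)) (w : Perm (suc m)) →
    IsHessenberg h → IsGenerator h w → IsWellOrganized w →
    IsGenerator h (wbar w)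
    × (∀ (u : Perm (suc m)) →
         InInterval (wbar w) u ⇔ (InInterval w u × (u ⟨$⟩ʳ fromℕ m ≡ Fin.zero)))
    × (∀ (i : Fin (suc m)) →
         InE w h (wbar w) i (fromℕ m)
         ⇔ Σ (Fin (suc m)) (λ y → InY w y × (y < (w ⟨$⟩ʳ fromℕ m))
                                 × (i ≡ w ⟨$⟩ˡ y) × (h (w ⟨$⟩ˡ y) ≡ fromℕ m)))
proposition4p2 m h w hess gen wo =
    wbar-generator h w hess gen wo
  , wbar-interval w wo
  , λ i → mk⇔ (InE-wbar-n̂⁻ w wo h i) (InE-wbar-n̂⁺ w wo h i)
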